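{- Let $(G_n)$ be a sequence of connected graphs with minimum degree $\delta(G_n)\to\infty$. Then $D(G_n)\to1/2$.
   Context: All graphs are finite and simple. For a graph $G$, a non-empty set $S\subseteq V(G)$ is a connected set if $G[S]$ is connected. For an $n$-vertex connected graph $G$, the connected set density $D(G)$ is the average cardinality of the connected sets of $G$ divided by $n$. -}

module Defs where

open import Data.Nat using (ℕ; zero; suc; _+_; _*_; _≤_)
open import Data.Bool using (Bool; true; false; _∧_; _∨_; if_then_else_; not)
open import Data.Fin using (Fin)
open import Data.Fin.Properties using (_≟_)
open import Data.List using (List; []; _∷_; map; filter; length; allFin)
open import Data.Nat.ListAction using (sum)
open import Data.List.Base using (concatMap)
open import Data.Vec using (Vec; []; _∷_; lookup; toList)
open import Data.Integer using (+_)
open import Data.Rational using (ℚ; 0ℚ; _/_)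
open import Data.Product using (Σ; _×_; ∃)
open import Relation.Binary.PropositionalEquality using (_≡_)
open import Relation.Nullary.Decidable using (⌊_⌋)

record Graph (n : ℕ) : Set where
  field
    adj    : Fin n → Fin n → Bool
    sym    : ∀ i j → adj i j ≡ adj j i
    irrefl : ∀ i → adj i i ≡ false
open Graph public

Subset : ℕ → Set
Subset n = Vec Bool n

_∈S_ : ∀ {n} → Fin n → Subset n → Bool
v ∈S S = lookup S v

allSubsets : (n : ℕ) → List (Subset n)
allSubsets zero = [] ∷ []
allSubsets (suc n) = concatMap (λ s → (false ∷ s) ∷ (true ∷ s) ∷ []) (allSubsets n)

card : ∀ {n} → Subset n → ℕ
card [] = 0
card (true ∷ s) = suc (card s)
card (false ∷ s) = card s

anyFin : ∀ {n} → (Fin n → Bool) → Bool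
anyFin {n} p = Data.List.foldr _∨_ false (map p (allFin n))

allFin' : ∀ {n} → (Fin n → Bool) → Bool
allFin' {n} p = Data.List.foldr _∧_ true (map p (allFin n))

-- reach G S k u w : there is a walk of length ≤ k from u to w in G
-- all of whose vertices after u lie in S (u itself is required in S by the caller).
reach : ∀ {n} → Graph n → Subset n → ℕ → Fin n → Fin n → Bool
reach G S zero u w = ⌊ u ≟ w ⌋
reach G S (suc k) u w =
  reach G S k u w ∨ anyFin (λ v → reach G S k u v ∧ adj G v w ∧ (w ∈S S))

-- G[S] is connected: S nonempty and any two vertices of S are joined by a
-- walk inside S (walks of length ≤ n suffice, n = number of vertices).
isConnectedSet : ∀ {n} → Graph n → Subset n → Bool
isConnectedSet {n} G S =
  anyFin (λ v → v ∈S S) ∧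
  allFin' (λ u → allFin' (λ w →
     not (u ∈S S ∧ w ∈S S) ∨ reach G S n u w))

fullSet : (n : ℕ) → Subset n
fullSet zero = []
fullSet (suc n) = true ∷ fullSet n

-- G is connected (in particular it has at least one vertex).
Connected : ∀ {n} → Graph n → Set
Connected {n} G = isConnectedSet G (fullSet n) ≡ true

connectedSets : ∀ {n} → Graph n → List (Subset n)
connectedSets {n} G = filter (λ S → isConnectedSet G S Data.Bool.≟ true) (allSubsets n)

-- a / d as a rational, with a / 0 := 0 (never used for connected graphs)
ratio : ℕ → ℕ → ℚ
ratio a zero = 0ℚ
ratio a (suc d) = (+ a) / suc d

-- connected set density: (average size of a connected set) / n
--   = (Σ_{S connected} |S|) / (#connected sets · n)
density : ∀ {n} → Graph n → ℚ
density {n} G =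
  ratio (sum (map card (connectedSets G))) (length (connectedSets G) * n)

degree : ∀ {n} → Graph n → Fin n → ℕ
degree {n} G v = length (filter (λ u → adj G v u Data.Bool.≟ true) (allFin n))

MinDegAtLeast : ∀ {n} → Graph n → ℕ → Set
MinDegAtLeast {n} G M = ∀ (v : Fin n) → M ≤ degree G v

-- Large minimum degree gives a small connected dominating set C (greedy domination, then joining
-- the pieces), and every superset of C is connected, so there are at least 2 ^ (n - |C|) connected
-- sets with |C| ≤ n / M.  Weighting each S ⊆ V by p ^ |S| · q ^ (n - |S|) (p = l + 1, q = l + 3)
-- gives a Chernoff bound: the sets of size outside (1/2 ± 1/(p + q)) n are fewer than a 1/q fraction
-- of those supersets.  Hence the typical connected set has size close to n / 2, and the average
-- connected set size is within n / (l + 2) of n / 2.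

module Submission where

module Sums where

  open import Defs using (anyFin; allFin')
  open import Data.Bool using (Bool; true; false; _∧_; _∨_)
  import Data.Bool as Bool
  open import Data.Bool.Properties using (T-≡)
  open import Data.Fin using (Fin; zero; suc)
  open import Data.Fin.Properties using (_≟_)
  open import Data.List using (List; []; _∷_; map; filter; length; tabulate)
  import Data.List.Relation.Unary.All.Properties as All
  import Data.List.Relation.Unary.Any.Properties as Any
  open import Data.Nat using (ℕ; zero; suc; _+_; _*_; _≤_; _<_; z≤n)
  open import Data.Nat.ListAction using (sum)
  open import Data.Nat.Properties hiding (_≟_)
  open import Data.Product using (∃; _×_; _,_)
  open import Data.Sum using (_⊎_; inj₁; inj₂)
  open import Function using (_∘_; Equivalence)
  open import Relation.Binary.PropositionalEquality
  open import Relation.Nullary using (yes; no)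
  open import Relation.Nullary.Decidable using (⌊_⌋)
  import Algebra.Properties.CommutativeSemigroup +-commutativeSemigroup as +-CS
  open import Algebra.Properties.Semiring.Sum +-*-semiring public
    using (sum-syntax; ∑-distrib-+; ∑-comm; sum-cong-≗; sum-replicate-zero; *-distribˡ-sum)

  ∨-true⁻ : ∀ a b → a ∨ b ≡ true → a ≡ true ⊎ b ≡ true
  ∨-true⁻ true b e = inj₁ refl
  ∨-true⁻ false b e = inj₂ e

  ∨-trueˡ : ∀ a b → a ≡ true → a ∨ b ≡ true
  ∨-trueˡ true b e = refl

  ∨-trueʳ : ∀ a b → b ≡ true → a ∨ b ≡ true
  ∨-trueʳ true b e = refl
  ∨-trueʳ false b e = e

  ∧-true⁻ : ∀ a b → a ∧ b ≡ true → a ≡ true × b ≡ true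
  ∧-true⁻ true true e = refl , refl

  ∧-true⁺ : ∀ {a b} → a ≡ true → b ≡ true → a ∧ b ≡ true
  ∧-true⁺ refl refl = refl

  true≢false : ∀ {a} → a ≡ true → a ≡ false → ∀ {ℓ} {A : Set ℓ} → A
  true≢false refl ()

  true-or-false : ∀ a → a ≡ true ⊎ a ≡ false
  true-or-false true = inj₁ refl
  true-or-false false = inj₂ refl

  anyFin⁻ : ∀ {n} (p : Fin n → Bool) → anyFin p ≡ true → ∃ λ v → p v ≡ true
  anyFin⁻ p e with Any.tabulate⁻ (Any.any⁻ p _ (Equivalence.from T-≡ e))
  ... | v , pv = v , Equivalence.to T-≡ pv

  anyFin⁺ : ∀ {n} (p : Fin n → Bool) v → p v ≡ true → anyFin p ≡ true
  anyFin⁺ p v e = Equivalence.to T-≡ (Any.any⁺ p (Any.tabulate⁺ v (Equivalence.from T-≡ e)))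

  allFin⁻ : ∀ {n} (p : Fin n → Bool) → allFin' p ≡ true → ∀ v → p v ≡ true
  allFin⁻ p e v = Equivalence.to T-≡ (All.tabulate⁻ (All.all⁺ p _ (Equivalence.from T-≡ e)) v)

  allFin⁺ : ∀ {n} (p : Fin n → Bool) → (∀ v → p v ≡ true) → allFin' p ≡ true
  allFin⁺ p e = Equivalence.to T-≡ (All.all⁻ p (All.tabulate⁺ (Equivalence.from T-≡ ∘ e)))

  ⟦_⟧ : Bool → ℕ
  ⟦ true ⟧ = 1
  ⟦ false ⟧ = 0

  ⟦⟧≤1 : ∀ b → ⟦ b ⟧ ≤ 1
  ⟦⟧≤1 true = ≤-refl
  ⟦⟧≤1 false = z≤n

  ∑-mono-≤ : ∀ {n} {f g : Fin n → ℕ} → (∀ i → f i ≤ g i) → ∑[ i < n ] f i ≤ ∑[ i < n ] g i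
  ∑-mono-≤ {zero} le = z≤n
  ∑-mono-≤ {suc n} le = +-mono-≤ (le zero) (∑-mono-≤ (le ∘ suc))

  ∑-mono-< : ∀ {n} {f g : Fin n → ℕ} → (∀ i → f i ≤ g i) → ∀ v → f v < g v →
    ∑[ i < n ] f i < ∑[ i < n ] g i
  ∑-mono-< le zero lt = +-mono-<-≤ lt (∑-mono-≤ (le ∘ suc))
  ∑-mono-< le (suc v) lt = +-mono-≤-< (le zero) (∑-mono-< (le ∘ suc) v lt)

  ∑-≤-* : ∀ {n} {f : Fin n → ℕ} c → (∀ i → f i ≤ c) → ∑[ i < n ] f i ≤ n * c
  ∑-≤-* {zero} c le = z≤n
  ∑-≤-* {suc n} c le = +-mono-≤ (le zero) (∑-≤-* c (le ∘ suc))

  term≤∑ : ∀ {n} (f : Fin n → ℕ) i → f i ≤ ∑[ j < n ] f j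
  term≤∑ f zero = m≤m+n _ _
  term≤∑ f (suc i) = ≤-trans (term≤∑ (f ∘ suc) i) (m≤n+m _ (f zero))

  ∑-⟦≟⟧ : ∀ {n} (v : Fin n) → ∑[ i < n ] ⟦ ⌊ i ≟ v ⌋ ⟧ ≡ 1
  ∑-⟦≟⟧ {suc n} zero = cong suc (sum-replicate-zero n)
  ∑-⟦≟⟧ {suc n} (suc v) = trans (sum-cong-≗ ⟦suc≟suc⟧) (∑-⟦≟⟧ v)
    where
    ⟦suc≟suc⟧ : ∀ (i : Fin n) → ⟦ ⌊ suc i ≟ suc v ⌋ ⟧ ≡ ⟦ ⌊ i ≟ v ⌋ ⟧
    ⟦suc≟suc⟧ i with i ≟ v
    ... | yes _ = refl
    ... | no _ = refl

  argmax : ∀ {n} → Fin n → (f : Fin n → ℕ) → ∃ λ v → ∀ i → f i ≤ f v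
  argmax {suc zero} _ f = zero , λ { zero → ≤-refl }
  argmax {suc (suc n)} _ f with argmax zero (f ∘ suc)
  ... | w , max with f zero ≤? f (suc w)
  ...   | yes le = suc w , λ { zero → le ; (suc i) → max i }
  ...   | no gt = zero , λ { zero → ≤-refl ; (suc i) → ≤-trans (max i) (<⇒≤ (≰⇒> gt)) }

  ∑≤n*max : ∀ {n} → Fin n → (f : Fin n → ℕ) → ∃ λ v → ∑[ i < n ] f i ≤ n * f v
  ∑≤n*max v₀ f with argmax v₀ f
  ... | v , max = v , ∑-≤-* (f v) max

  ∑∈ : {A : Set} → List A → (A → ℕ) → ℕ
  ∑∈ xs f = sum (map f xs)

  syntax ∑∈ xs (λ x → e) = ∑[ x ∈ xs ] e

  module _ {A : Set} where

    ∑∈-mono-≤ : {f g : A → ℕ} (xs : List A) → (∀ x → f x ≤ g x) → ∑[ x ∈ xs ] f x ≤ ∑[ x ∈ xs ] g x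
    ∑∈-mono-≤ [] le = z≤n
    ∑∈-mono-≤ (x ∷ xs) le = +-mono-≤ (le x) (∑∈-mono-≤ xs le)

    ∑∈-cong : {f g : A → ℕ} (xs : List A) → (∀ x → f x ≡ g x) → ∑[ x ∈ xs ] f x ≡ ∑[ x ∈ xs ] g x
    ∑∈-cong [] eq = refl
    ∑∈-cong (x ∷ xs) eq = cong₂ _+_ (eq x) (∑∈-cong xs eq)

    ∑∈-distrib-+ : (f g : A → ℕ) (xs : List A) →
      ∑[ x ∈ xs ] (f x + g x) ≡ ∑[ x ∈ xs ] f x + ∑[ x ∈ xs ] g x
    ∑∈-distrib-+ f g [] = refl
    ∑∈-distrib-+ f g (x ∷ xs) rewrite ∑∈-distrib-+ f g xs =
      +-CS.interchange (f x) (g x) (∑[ x ∈ xs ] f x) (∑[ x ∈ xs ] g x)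

    *-distribˡ-∑∈ : ∀ c (f : A → ℕ) (xs : List A) → c * ∑[ x ∈ xs ] f x ≡ ∑[ x ∈ xs ] (c * f x)
    *-distribˡ-∑∈ c f [] = *-zeroʳ c
    *-distribˡ-∑∈ c f (x ∷ xs) =
      trans (*-distribˡ-+ c (f x) _) (cong (c * f x +_) (*-distribˡ-∑∈ c f xs))

    ∑∈-filter : (p : A → Bool) (f : A → ℕ) (xs : List A) →
      ∑[ x ∈ filter (λ x → p x Bool.≟ true) xs ] f x ≡ ∑[ x ∈ xs ] (⟦ p x ⟧ * f x)
    ∑∈-filter p f [] = refl
    ∑∈-filter p f (x ∷ xs) with p x
    ... | true = cong₂ _+_ (sym (+-identityʳ (f x))) (∑∈-filter p f xs)
    ... | false = ∑∈-filter p f xs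

    length-filter : (p : A → Bool) (xs : List A) →
      length (filter (λ x → p x Bool.≟ true) xs) ≡ ∑[ x ∈ xs ] ⟦ p x ⟧
    length-filter p [] = refl
    length-filter p (x ∷ xs) with p x
    ... | true = cong suc (length-filter p xs)
    ... | false = length-filter p xs

    ∑∈-tabulate : ∀ {n} (g : Fin n → A) (f : A → ℕ) → ∑[ x ∈ tabulate g ] f x ≡ ∑[ i < n ] f (g i)
    ∑∈-tabulate {zero} g f = refl
    ∑∈-tabulate {suc n} g f = cong (f (g zero) +_) (∑∈-tabulate (g ∘ suc) f)

module Walks where

  open import Defs hiding (sym)
  open Sums
  open import Data.Bool using (Bool; true; false; _∧_; _∨_; not)
  open import Data.Empty using (⊥-elim)
  open import Data.Fin using (Fin; zero; suc)
  open import Data.Fin.Properties using (_≟_)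
  open import Data.List using (allFin)
  open import Data.Nat using (ℕ; zero; suc; _+_; _*_; _≤_; _<_; z≤n; s≤s; _≤′_; ≤′-refl; ≤′-step)
  open import Data.Nat.Properties hiding (_≟_)
  open import Data.Product using (∃; _×_; _,_; proj₁; proj₂)
  open import Data.Sum using (_⊎_; inj₁; inj₂)
  open import Data.Vec using ([]; _∷_)
  open import Function using (id)
  open import Relation.Binary.PropositionalEquality
  open import Relation.Nullary using (yes; no)

  _⊆_ : ∀ {n} → Subset n → Subset n → Set
  C ⊆ S = ∀ v → v ∈S C ≡ true → v ∈S S ≡ true

  ∅ : ∀ {n} → Subset n
  ∅ {zero} = []
  ∅ {suc n} = false ∷ ∅

  insert : ∀ {n} → Fin n → Subset n → Subset n
  insert zero (b ∷ S) = true ∷ S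
  insert (suc i) (b ∷ S) = b ∷ insert i S

  ∉∅ : ∀ {n} (u : Fin n) → u ∈S ∅ ≡ false
  ∉∅ zero = refl
  ∉∅ (suc u) = ∉∅ u

  ∈-fullSet : ∀ {n} (u : Fin n) → u ∈S fullSet n ≡ true
  ∈-fullSet zero = refl
  ∈-fullSet (suc u) = ∈-fullSet u

  ∈-insert⁻ : ∀ {n} (v : Fin n) (S : Subset n) u → u ∈S insert v S ≡ true → u ≡ v ⊎ u ∈S S ≡ true
  ∈-insert⁻ zero (b ∷ S) zero e = inj₁ refl
  ∈-insert⁻ zero (b ∷ S) (suc u) e = inj₂ e
  ∈-insert⁻ (suc v) (b ∷ S) zero e = inj₂ e
  ∈-insert⁻ (suc v) (b ∷ S) (suc u) e with ∈-insert⁻ v S u e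
  ... | inj₁ refl = inj₁ refl
  ... | inj₂ u∈S = inj₂ u∈S

  ∈-insert-self : ∀ {n} (v : Fin n) (S : Subset n) → v ∈S insert v S ≡ true
  ∈-insert-self zero (b ∷ S) = refl
  ∈-insert-self (suc v) (b ∷ S) = ∈-insert-self v S

  ⊆-insert : ∀ {n} (v : Fin n) (S : Subset n) → S ⊆ insert v S
  ⊆-insert zero (b ∷ S) zero e = refl
  ⊆-insert zero (b ∷ S) (suc u) e = e
  ⊆-insert (suc v) (b ∷ S) zero e = e
  ⊆-insert (suc v) (b ∷ S) (suc u) e = ⊆-insert v S u e

  card-insert : ∀ {n} (v : Fin n) (S : Subset n) → card (insert v S) ≤ suc (card S)
  card-insert zero (true ∷ S) = n≤1+n _
  card-insert zero (false ∷ S) = ≤-refl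
  card-insert (suc v) (true ∷ S) = s≤s (card-insert v S)
  card-insert (suc v) (false ∷ S) = card-insert v S

  card-∅ : ∀ {n} → card (∅ {n}) ≡ 0
  card-∅ {zero} = refl
  card-∅ {suc n} = card-∅ {n}

  card≤n : ∀ {n} (S : Subset n) → card S ≤ n
  card≤n [] = z≤n
  card≤n (true ∷ S) = s≤s (card≤n S)
  card≤n (false ∷ S) = m≤n⇒m≤1+n (card≤n S)

  card≡∑ : ∀ {n} (S : Subset n) → card S ≡ ∑[ i < n ] ⟦ i ∈S S ⟧
  card≡∑ [] = refl
  card≡∑ (true ∷ S) = cong suc (card≡∑ S)
  card≡∑ (false ∷ S) = card≡∑ S

  degree≡∑ : ∀ {n} (G : Graph n) v → degree G v ≡ ∑[ u < n ] ⟦ adj G v u ⟧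
  degree≡∑ {n} G v = trans (length-filter (adj G v) (allFin n)) (∑∈-tabulate id (λ u → ⟦ adj G v u ⟧))

  degree≤n : ∀ {n} (G : Graph n) v → degree G v ≤ n
  degree≤n {n} G v = subst (_≤ n) (sym (degree≡∑ G v))
    (subst (∑[ u < n ] ⟦ adj G v u ⟧ ≤_) (*-identityʳ n) (∑-≤-* 1 (λ u → ⟦⟧≤1 (adj G v u))))

  module _ {n} (G : Graph n) where

    adj-sym : ∀ {x y} → adj G x y ≡ true → adj G y x ≡ true
    adj-sym {x} {y} e = trans (Graph.sym G y x) e

    reach-refl : ∀ S (u : Fin n) → reach G S 0 u u ≡ true
    reach-refl S u with u ≟ u
    ... | yes _ = refl
    ... | no u≢u = ⊥-elim (u≢u refl)

    reach-zero⁻ : ∀ S {u w : Fin n} → reach G S 0 u w ≡ true → u ≡ w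
    reach-zero⁻ S {u} {w} e with u ≟ w
    ... | yes u≡w = u≡w

    reach-suc⁻ : ∀ S k {u w : Fin n} → reach G S (suc k) u w ≡ true →
      reach G S k u w ≡ true ⊎ ∃ λ z → reach G S k u z ≡ true × adj G z w ≡ true × w ∈S S ≡ true
    reach-suc⁻ S k {u} {w} e with ∨-true⁻ (reach G S k u w) _ e
    ... | inj₁ r = inj₁ r
    ... | inj₂ r with anyFin⁻ (λ v → reach G S k u v ∧ adj G v w ∧ (w ∈S S)) r
    ...   | z , q with ∧-true⁻ (reach G S k u z) _ q
    ...     | r′ , q′ = inj₂ (z , r′ , ∧-true⁻ (adj G z w) _ q′)

    reach-suc : ∀ S k {u w : Fin n} → reach G S k u w ≡ true → reach G S (suc k) u w ≡ true
    reach-suc S k {u} {w} e = ∨-trueˡ (reach G S k u w) _ e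

    reach-snoc : ∀ S k {u x w : Fin n} → reach G S k u x ≡ true → adj G x w ≡ true →
      w ∈S S ≡ true → reach G S (suc k) u w ≡ true
    reach-snoc S k {u} {x} {w} r a s =
      ∨-trueʳ (reach G S k u w) _
        (anyFin⁺ (λ v → reach G S k u v ∧ adj G v w ∧ (w ∈S S)) x (∧-true⁺ r (∧-true⁺ a s)))

    reach-mono-≤ : ∀ S {k k′} {u w : Fin n} → k ≤ k′ → reach G S k u w ≡ true → reach G S k′ u w ≡ true
    reach-mono-≤ S le = go (≤⇒≤′ le)
      where
      go : ∀ {k k′} {u w : Fin n} → k ≤′ k′ → reach G S k u w ≡ true → reach G S k′ u w ≡ true
      go ≤′-refl e = e
      go {k′ = suc k′} (≤′-step le) e = reach-suc S k′ (go le e)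

    reach-cons : ∀ S k {u x w : Fin n} → adj G u x ≡ true → x ∈S S ≡ true →
      reach G S k x w ≡ true → reach G S (suc k) u w ≡ true
    reach-cons S zero {u} a s r with reach-zero⁻ S r
    ... | refl = reach-snoc S 0 (reach-refl S u) a s
    reach-cons S (suc k) a s r with reach-suc⁻ S k r
    ... | inj₁ r′ = reach-suc S (suc k) (reach-cons S k a s r′)
    ... | inj₂ (z , r′ , a′ , s′) = reach-snoc S (suc k) (reach-cons S k a s r′) a′ s′

    reach-mono-⊆ : ∀ {S S′} k {u w : Fin n} → S ⊆ S′ → reach G S k u w ≡ true → reach G S′ k u w ≡ true
    reach-mono-⊆ zero sub r = r
    reach-mono-⊆ {S} {S′} (suc k) {u} {w} sub r with reach-suc⁻ S k r
    ... | inj₁ r′ = reach-suc S′ k (reach-mono-⊆ k sub r′)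
    ... | inj₂ (z , r′ , a , s) = reach-snoc S′ k (reach-mono-⊆ k sub r′) a (sub w s)

    reach-crossing-edge : ∀ S k (X : Fin n → Bool) {u w : Fin n} → reach G S k u w ≡ true →
      X u ≡ true → X w ≡ false → ∃ λ a → ∃ λ b → X a ≡ true × X b ≡ false × adj G a b ≡ true
    reach-crossing-edge S zero X r Xu Xw with reach-zero⁻ S r
    ... | refl = true≢false Xu Xw
    reach-crossing-edge S (suc k) X r Xu Xw with reach-suc⁻ S k r
    ... | inj₁ r′ = reach-crossing-edge S k X r′ Xu Xw
    ... | inj₂ (z , r′ , a , _) with true-or-false (X z)
    ...   | inj₁ Xz = z , _ , Xz , Xw , a
    ...   | inj₂ Xz = reach-crossing-edge S k X r′ Xu Xz

    Dominated : Subset n → Fin n → Set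
    Dominated C v = v ∈S C ≡ true ⊎ ∃ λ x → x ∈S C ≡ true × adj G x v ≡ true

    Dominating : Subset n → Set
    Dominating C = ∀ v → Dominated C v

    DiamAtMost : Subset n → ℕ → Set
    DiamAtMost C k = ∀ u w → u ∈S C ≡ true → w ∈S C ≡ true → reach G C k u w ≡ true

    dominated-mono : ∀ {C C′} → C ⊆ C′ → ∀ {v} → Dominated C v → Dominated C′ v
    dominated-mono sub (inj₁ v∈C) = inj₁ (sub _ v∈C)
    dominated-mono sub (inj₂ (x , x∈C , a)) = inj₂ (x , sub x x∈C , a)

    diam-singleton : ∀ v → DiamAtMost (insert v ∅) 0
    diam-singleton v u w u∈ w∈ with ∈-insert⁻ v ∅ u u∈ | ∈-insert⁻ v ∅ w w∈
    ... | inj₁ refl | inj₁ refl = reach-refl (insert u ∅) u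
    ... | inj₂ u∈∅ | _ = true≢false u∈∅ (∉∅ u)
    ... | _ | inj₂ w∈∅ = true≢false w∈∅ (∉∅ w)

    private
      data NewMember (C : Subset n) (v u : Fin n) : Set where
        old : u ∈S C ≡ true → NewMember C v u
        new : u ≡ v → ∀ x → x ∈S C ≡ true → adj G x v ≡ true → NewMember C v u

      newMember : ∀ C v u → Dominated C v → u ∈S insert v C ≡ true → NewMember C v u
      newMember C v u dom u∈ with ∈-insert⁻ v C u u∈ | dom
      ... | inj₂ u∈C | _ = old u∈C
      ... | inj₁ refl | inj₁ u∈C = old u∈C
      ... | inj₁ refl | inj₂ (x , x∈C , a) = new refl x x∈C a

    diam-insert : ∀ C k v → DiamAtMost C k → Dominated C v → DiamAtMost (insert v C) (suc k)
    diam-insert C k v diam dom u w u∈ w∈ with newMember C v u dom u∈ | newMember C v w dom w∈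
    ... | old u∈C | old w∈C =
      reach-suc (insert v C) k (reach-mono-⊆ k (⊆-insert v C) (diam u w u∈C w∈C))
    ... | old u∈C | new refl x x∈C a =
      reach-snoc (insert v C) k (reach-mono-⊆ k (⊆-insert v C) (diam u x u∈C x∈C)) a (∈-insert-self v C)
    ... | new refl x x∈C a | old w∈C =
      reach-cons (insert v C) k (adj-sym a) (⊆-insert v C x x∈C)
        (reach-mono-⊆ k (⊆-insert v C) (diam x w x∈C w∈C))
    ... | new refl _ _ _ | new refl _ _ _ = reach-mono-≤ (insert v C) {k′ = suc k} z≤n (reach-refl (insert v C) u)

    UpwardConnected : Subset n → Set
    UpwardConnected C = ∀ S → C ⊆ S → isConnectedSet G S ≡ true

    superset-connected : ∀ {C k v₀} → DiamAtMost C k → Dominating C → 2 + k ≤ n →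
      v₀ ∈S C ≡ true → UpwardConnected C
    superset-connected {C} {k} {v₀} diam dom k+2≤n v₀∈C S C⊆S =
      ∧-true⁺ (anyFin⁺ (_∈S S) v₀ (C⊆S v₀ v₀∈C))
              (allFin⁺ _ (λ u → allFin⁺ _ (λ w → joined u w)))
      where
      toDominated : ∀ c {w} → c ∈S C ≡ true → w ∈S S ≡ true → Dominated C w → reach G S (suc k) c w ≡ true
      toDominated c {w} c∈C _ (inj₁ w∈C) = reach-suc S k (reach-mono-⊆ k C⊆S (diam c w c∈C w∈C))
      toDominated c c∈C w∈S (inj₂ (x , x∈C , a)) =
        reach-snoc S k (reach-mono-⊆ k C⊆S (diam c x c∈C x∈C)) a w∈S
      joined : ∀ u w → not (u ∈S S ∧ w ∈S S) ∨ reach G S n u w ≡ true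
      joined u w with true-or-false (u ∈S S ∧ w ∈S S)
      ... | inj₂ notBoth rewrite notBoth = refl
      ... | inj₁ both rewrite both with ∧-true⁻ (u ∈S S) _ both
      ...   | u∈S , w∈S = reach-mono-≤ S k+2≤n (fromDominated (dom u))
        where
        fromDominated : Dominated C u → reach G S (suc (suc k)) u w ≡ true
        fromDominated (inj₁ u∈C) = reach-suc S (suc k) (toDominated u u∈C w∈S (dom w))
        fromDominated (inj₂ (x , x∈C , a)) =
          reach-cons S (suc k) (adj-sym a) (C⊆S x x∈C) (toDominated x x∈C w∈S (dom w))

    module _ (connected : Connected G) where

      someVertex : Fin n
      someVertex = proj₁ (anyFin⁻ (_∈S fullSet n) (proj₁ (∧-true⁻ _ _ connected)))

      reach-connected : ∀ u w → reach G (fullSet n) n u w ≡ true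
      reach-connected u w
        with allFin⁻ _ (allFin⁻ _ (proj₂ (∧-true⁻ (anyFin (_∈S fullSet n)) _ connected)) u) w
      ... | joined rewrite ∈-fullSet u | ∈-fullSet w = joined

module Domination where

  open import Defs hiding (sym)
  open Sums
  open Walks
  open import Data.Bool using (Bool; true; false; _∧_; _∨_; not)
  open import Data.Empty using (⊥-elim)
  open import Data.Fin using (Fin; zero; suc)
  open import Data.Fin.Properties using (_≟_)
  open import Data.Nat using (ℕ; zero; suc; _+_; _*_; _≤_; _<_; z≤n; s≤s)
  open import Data.Nat.Properties hiding (_≟_)
  open import Data.Product using (∃; _×_; _,_)
  open import Data.Sum using (inj₁; inj₂)
  open import Relation.Binary.PropositionalEquality
  open import Relation.Nullary using (yes; no)
  open import Relation.Nullary.Decidable using (⌊_⌋)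
  import Algebra.Properties.CommutativeSemigroup *-commutativeSemigroup as *-CS

  potential-step : ∀ a R {c c′ U U′ g} → c′ ≤ suc c → U′ + g ≤ U → a ≤ R * g →
    a * c′ + R * U′ ≤ a * c + R * U
  potential-step a R {c} {c′} {U} {U′} {g} c′≤ U′+g≤ a≤ = begin
    a * c′ + R * U′         ≤⟨ +-monoˡ-≤ (R * U′) (*-monoʳ-≤ a c′≤) ⟩
    a * suc c + R * U′      ≡⟨ cong (_+ R * U′) (trans (*-suc a c) (+-comm a (a * c))) ⟩
    a * c + a + R * U′      ≡⟨ +-assoc (a * c) a (R * U′) ⟩
    a * c + (a + R * U′)    ≤⟨ +-monoʳ-≤ (a * c) (+-monoˡ-≤ (R * U′) a≤) ⟩
    a * c + (R * g + R * U′) ≡⟨ cong (a * c +_) (sym (*-distribˡ-+ R g U′)) ⟩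
    a * c + R * (g + U′)    ≤⟨ +-monoʳ-≤ (a * c) (*-monoʳ-≤ R (subst (_≤ U) (+-comm U′ g) U′+g≤)) ⟩
    a * c + R * U           ∎
    where open ≤-Reasoning

  nonzero-factor : ∀ R g {k} → suc k ≤ R * g → 1 ≤ g
  nonzero-factor R zero le rewrite *-zeroʳ R = ⊥-elim (<⇒≱ le z≤n)
  nonzero-factor R (suc g) le = s≤s z≤n

  two-phase-bound : ∀ K {d n c₁ u₁ c₂} → 4 * (K * K) ≤ suc d → suc d * c₁ ≤ 2 * K * n →
    2 * K * u₁ ≤ n → c₂ ≤ c₁ + u₁ → K * c₂ ≤ n
  two-phase-bound zero _ _ _ _ = z≤n
  two-phase-bound K@(suc _) {d} {n} {c₁} {u₁} {c₂} 4K²≤ dc₁≤ 2Ku₁≤n c₂≤ =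
    *-cancelˡ-≤ 2 (begin
      2 * (K * c₂)        ≡⟨ *-assoc 2 K c₂ ⟨
      2 * K * c₂          ≤⟨ *-monoʳ-≤ (2 * K) c₂≤ ⟩
      2 * K * (c₁ + u₁)   ≡⟨ *-distribˡ-+ (2 * K) c₁ u₁ ⟩
      2 * K * c₁ + 2 * K * u₁ ≤⟨ +-mono-≤ 2Kc₁≤n 2Ku₁≤n ⟩
      n + n               ≡⟨ cong (n +_) (+-identityʳ n) ⟨
      2 * n               ∎)
    where
    open ≤-Reasoning
    2Kc₁≤n : 2 * K * c₁ ≤ n
    2Kc₁≤n = *-cancelˡ-≤ (2 * K) (begin
      2 * K * (2 * K * c₁)   ≡⟨ *-assoc (2 * K) (2 * K) c₁ ⟨
      2 * K * (2 * K) * c₁   ≡⟨ cong (_* c₁) (*-CS.interchange 2 K 2 K) ⟩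
      4 * (K * K) * c₁       ≤⟨ *-monoˡ-≤ c₁ 4K²≤ ⟩
      suc d * c₁             ≤⟨ dc₁≤ ⟩
      2 * K * n              ∎)

  module _ {n} (G : Graph n) where

    dominatedᵇ : Subset n → Fin n → Bool
    dominatedᵇ D u = u ∈S D ∨ anyFin (λ x → x ∈S D ∧ adj G x u)

    dominatedᵇ⁻ : ∀ D u → dominatedᵇ D u ≡ true → Dominated G D u
    dominatedᵇ⁻ D u e with ∨-true⁻ (u ∈S D) _ e
    ... | inj₁ u∈D = inj₁ u∈D
    ... | inj₂ r with anyFin⁻ (λ x → x ∈S D ∧ adj G x u) r
    ...   | x , q = inj₂ (x , ∧-true⁻ (x ∈S D) _ q)

    dominatedᵇ⁺ : ∀ D u → Dominated G D u → dominatedᵇ D u ≡ true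
    dominatedᵇ⁺ D u (inj₁ u∈D) = ∨-trueˡ _ _ u∈D
    dominatedᵇ⁺ D u (inj₂ (x , x∈D , a)) =
      ∨-trueʳ (u ∈S D) _ (anyFin⁺ (λ x → x ∈S D ∧ adj G x u) x (∧-true⁺ x∈D a))

    covers : Fin n → Fin n → Bool
    covers v u = ⌊ u ≟ v ⌋ ∨ adj G v u

    covers-dominated : ∀ D v u → covers v u ≡ true → Dominated G (insert v D) u
    covers-dominated D v u e with u ≟ v
    ... | yes refl = inj₁ (∈-insert-self v D)
    ... | no _ = inj₂ (v , ∈-insert-self v D , e)

    undominated : Subset n → ℕ
    undominated D = ∑[ u < n ] ⟦ not (dominatedᵇ D u) ⟧

    gain : Subset n → Fin n → ℕ
    gain D v = ∑[ u < n ] ⟦ not (dominatedᵇ D u) ∧ covers v u ⟧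

    undominated≤n : ∀ D → undominated D ≤ n
    undominated≤n D = subst (undominated D ≤_) (*-identityʳ n) (∑-≤-* 1 (λ u → ⟦⟧≤1 (not (dominatedᵇ D u))))

    undominated≤0⇒dominating : ∀ D → undominated D ≤ 0 → Dominating G D
    undominated≤0⇒dominating D U≤0 u = dominatedᵇ⁻ D u (⟦not⟧≤0 (dominatedᵇ D u) (≤-trans (term≤∑ _ u) U≤0))
      where
      ⟦not⟧≤0 : ∀ b → ⟦ not b ⟧ ≤ 0 → b ≡ true
      ⟦not⟧≤0 true _ = refl

    undominated-insert : ∀ D v → undominated (insert v D) + gain D v ≤ undominated D
    undominated-insert D v =
      subst (_≤ undominated D) (∑-distrib-+ (λ u → ⟦ not (dominatedᵇ (insert v D) u) ⟧) _)
        (∑-mono-≤ pointwise)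
      where
      stillDominated : ∀ u → dominatedᵇ D u ≡ true → Dominated G (insert v D) u
      stillDominated u dom = dominated-mono G {D} {insert v D} (⊆-insert v D) (dominatedᵇ⁻ D u dom)
      pointwise : ∀ u → ⟦ not (dominatedᵇ (insert v D) u) ⟧ + ⟦ not (dominatedᵇ D u) ∧ covers v u ⟧
                        ≤ ⟦ not (dominatedᵇ D u) ⟧
      pointwise u with true-or-false (dominatedᵇ D u)
      ... | inj₁ dom rewrite dom | dominatedᵇ⁺ (insert v D) u (stillDominated u dom) = z≤n
      ... | inj₂ undom rewrite undom with true-or-false (covers v u)
      ...   | inj₁ cov rewrite cov | dominatedᵇ⁺ (insert v D) u (covers-dominated D v u cov) = ≤-refl
      ...   | inj₂ uncov rewrite uncov = subst (_≤ 1) (sym (+-identityʳ _)) (⟦⟧≤1 _)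

    ∑-covers : ∀ u → ∑[ v < n ] ⟦ covers v u ⟧ ≡ suc (degree G u)
    ∑-covers u = begin
      ∑[ v < n ] ⟦ covers v u ⟧                         ≡⟨ sum-cong-≗ split ⟩
      ∑[ v < n ] (⟦ ⌊ v ≟ u ⌋ ⟧ + ⟦ adj G u v ⟧)           ≡⟨ ∑-distrib-+ (λ v → ⟦ ⌊ v ≟ u ⌋ ⟧) _ ⟩
      ∑[ v < n ] ⟦ ⌊ v ≟ u ⌋ ⟧ + ∑[ v < n ] ⟦ adj G u v ⟧  ≡⟨ cong₂ _+_ (∑-⟦≟⟧ u) (sym (degree≡∑ G u)) ⟩
      suc (degree G u)                                  ∎
      where
      open ≡-Reasoning
      split : ∀ v → ⟦ covers v u ⟧ ≡ ⟦ ⌊ v ≟ u ⌋ ⟧ + ⟦ adj G u v ⟧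
      split v with v ≟ u
      ... | yes refl rewrite Graph.irrefl G v with v ≟ v
      ...   | yes _ = refl
      ...   | no v≢v = ⊥-elim (v≢v refl)
      split v | no v≢u with u ≟ v
      ...   | yes u≡v = ⊥-elim (v≢u (sym u≡v))
      ...   | no _ = cong ⟦_⟧ (Graph.sym G v u)

    module _ {d} (minDeg : MinDegAtLeast G d) where

      ∑-gain : ∀ D → undominated D * suc d ≤ ∑[ v < n ] gain D v
      ∑-gain D = begin
        undominated D * suc d                   ≡⟨ *-comm (undominated D) (suc d) ⟩
        suc d * undominated D                   ≡⟨ *-distribˡ-sum (suc d) (λ u → ⟦ not (dominatedᵇ D u) ⟧) ⟩
        ∑[ u < n ] (suc d * ⟦ not (dominatedᵇ D u) ⟧)  ≤⟨ ∑-mono-≤ coveredAtLeast ⟩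
        ∑[ u < n ] ∑[ v < n ] ⟦ not (dominatedᵇ D u) ∧ covers v u ⟧
          ≡⟨ ∑-comm (λ u v → ⟦ not (dominatedᵇ D u) ∧ covers v u ⟧) ⟩
        ∑[ v < n ] gain D v                     ∎
        where
        open ≤-Reasoning
        coveredAtLeast : ∀ u → suc d * ⟦ not (dominatedᵇ D u) ⟧ ≤ ∑[ v < n ] ⟦ not (dominatedᵇ D u) ∧ covers v u ⟧
        coveredAtLeast u with not (dominatedᵇ D u)
        ... | false = ≤-trans (≤-reflexive (*-zeroʳ (suc d))) z≤n
        ... | true = begin
          suc d * 1                  ≡⟨ *-identityʳ (suc d) ⟩
          suc d                      ≤⟨ s≤s (minDeg u) ⟩
          suc (degree G u)           ≡⟨ ∑-covers u ⟨
          ∑[ v < n ] ⟦ covers v u ⟧  ∎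

      best-gain : Fin n → ∀ D → ∃ λ v → undominated D * suc d ≤ n * gain D v
      best-gain v₀ D with ∑≤n*max v₀ (gain D)
      ... | v , ∑≤ = v , ≤-trans (∑-gain D) ∑≤

    -- Each step adds one vertex but removes at least a / R undominated ones, so the potential
    -- a |D| + R · undominated D never increases.
    GreedyStep : ℕ → ℕ → ℕ → Set
    GreedyStep a R T = ∀ D → T < R * undominated D → ∃ λ v → a ≤ R * gain D v × 1 ≤ gain D v

    greedy : ∀ a R T → GreedyStep a R T → ∀ D → ∃ λ D′ → R * undominated D′ ≤ T ×
      a * card D′ + R * undominated D′ ≤ a * card D + R * undominated D
    greedy a R T step D = run (undominated D) D ≤-refl
      where
      open ≤-Reasoning
      run : ∀ fuel D → undominated D ≤ fuel → ∃ λ D′ → R * undominated D′ ≤ T ×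
        a * card D′ + R * undominated D′ ≤ a * card D + R * undominated D
      run fuel D U≤fuel with suc T ≤? R * undominated D
      ... | no T≮ = D , ≮⇒≥ T≮ , ≤-refl
      run zero D U≤0 | yes T< rewrite n≤0⇒n≡0 U≤0 | *-zeroʳ R = ⊥-elim (<⇒≱ T< z≤n)
      run (suc fuel) D U≤fuel | yes T< with step D T<
      ... | v , a≤ , 1≤gain with run fuel (insert v D) (≤-pred (begin
            suc (undominated (insert v D))         ≡⟨ +-comm 1 _ ⟩
            undominated (insert v D) + 1           ≤⟨ +-monoʳ-≤ _ 1≤gain ⟩
            undominated (insert v D) + gain D v    ≤⟨ undominated-insert D v ⟩
            undominated D                          ≤⟨ U≤fuel ⟩
            suc fuel                               ∎))
      ...   | D′ , done , potential = D′ , done ,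
        ≤-trans potential (potential-step a R (card-insert v D) (undominated-insert D v) a≤)

    module _ {d} (minDeg : MinDegAtLeast G d) (v₀ : Fin n) where

      greedy-step-heavy : ∀ R → GreedyStep (suc d) R n
      greedy-step-heavy R D n<RU with best-gain minDeg v₀ D
      ... | v , U*d≤n*g = v , d≤Rg , nonzero-factor R (gain D v) d≤Rg
        where
        open ≤-Reasoning
        g = gain D v
        d≤Rg : suc d ≤ R * g
        d≤Rg = <⇒≤ (*-cancelˡ-< n (suc d) (R * g) (begin-strict
          n * suc d                ≤⟨ m≤n+m (n * suc d) d ⟩
          d + n * suc d            <⟨ n<1+n _ ⟩
          suc n * suc d            ≤⟨ *-monoˡ-≤ (suc d) n<RU ⟩
          R * undominated D * suc d ≡⟨ *-assoc R (undominated D) (suc d) ⟩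
          R * (undominated D * suc d) ≤⟨ *-monoʳ-≤ R U*d≤n*g ⟩
          R * (n * g)              ≡⟨ *-CS.x∙yz≈y∙xz R n g ⟩
          n * (R * g)              ∎))

      greedy-step-light : GreedyStep 1 1 0
      greedy-step-light D 0<U with best-gain minDeg v₀ D
      ... | v , U*d≤n*g = v , subst (1 ≤_) (sym (*-identityˡ (gain D v))) 1≤g , 1≤g
        where
        1≤g : 1 ≤ gain D v
        1≤g = nonzero-factor n (gain D v)
                (≤-trans (*-mono-≤ (subst (1 ≤_) (*-identityˡ _) 0<U) (s≤s z≤n)) U*d≤n*g)

      -- Greedy in two phases: while 2K · undominated D > n some vertex gains at least (d + 1) / 2K,
      -- afterwards each remaining undominated vertex costs one.
      small-dominating-set : ∀ K → 4 * (K * K) ≤ suc d → ∃ λ D → Dominating G D × K * card D ≤ n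
      small-dominating-set K 4K²≤ with greedy (suc d) (2 * K) n (greedy-step-heavy (2 * K)) ∅
      ... | D₁ , 2KU₁≤n , potential₁ with greedy 1 1 0 greedy-step-light D₁
      ...   | D₂ , U₂≤0 , potential₂ =
        D₂ , undominated≤0⇒dominating D₂ (subst (_≤ 0) (*-identityˡ _) U₂≤0) ,
        two-phase-bound K 4K²≤ phase₁ 2KU₁≤n phase₂
        where
        open ≤-Reasoning
        phase₁ : suc d * card D₁ ≤ 2 * K * n
        phase₁ = begin
          suc d * card D₁                                    ≤⟨ m≤m+n _ _ ⟩
          suc d * card D₁ + 2 * K * undominated D₁           ≤⟨ potential₁ ⟩
          suc d * card (∅ {n}) + 2 * K * undominated ∅       ≡⟨ cong (λ c → suc d * c + 2 * K * undominated ∅) (card-∅ {n}) ⟩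
          suc d * 0 + 2 * K * undominated ∅                  ≡⟨ cong (_+ 2 * K * undominated ∅) (*-zeroʳ (suc d)) ⟩
          2 * K * undominated ∅                              ≤⟨ *-monoʳ-≤ (2 * K) (undominated≤n ∅) ⟩
          2 * K * n                                          ∎
        phase₂ : card D₂ ≤ card D₁ + undominated D₁
        phase₂ = begin
          card D₂                                  ≡⟨ *-identityˡ (card D₂) ⟨
          1 * card D₂                              ≤⟨ m≤m+n _ _ ⟩
          1 * card D₂ + 1 * undominated D₂         ≤⟨ potential₂ ⟩
          1 * card D₁ + 1 * undominated D₁         ≡⟨ cong₂ _+_ (*-identityˡ (card D₁)) (*-identityˡ (undominated D₁)) ⟩
          card D₁ + undominated D₁                 ∎

module ConnectedDomination where

  open import Defs hiding (sym)
  open Sums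
  open Walks
  open Domination
  open import Data.Bool using (Bool; true; false; _∧_; not)
  import Data.Bool as Bool
  open import Data.Bool.Properties using (¬-not)
  open import Data.Fin using (Fin)
  open import Data.Fin.Properties using (all?; ¬∀⟶∃¬)
  open import Data.Nat using (ℕ; zero; suc; _+_; _*_; _≤_; _<_; z≤n; s≤s)
  open import Data.Nat.Properties hiding (_≟_)
  open import Data.Nat.Solver using (module +-*-Solver)
  open +-*-Solver using (solve; _:+_; _:*_; _:=_; con)
  open import Data.Product using (∃; _×_; _,_)
  open import Data.Sum using (inj₁; inj₂)
  open import Relation.Binary.PropositionalEquality
  open import Relation.Nullary using (yes; no)

  potential-drop : ∀ {x x′ m m′ B} → x′ ≤ 3 + x → suc m′ ≤ m → x + 3 * m ≤ B → x′ + 3 * m′ ≤ B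
  potential-drop {x} {x′} {m} {m′} {B} x′≤ m′<m ≤B = begin
    x′ + 3 * m′         ≤⟨ +-monoˡ-≤ (3 * m′) x′≤ ⟩
    3 + x + 3 * m′      ≡⟨ cong (_+ 3 * m′) (+-comm 3 x) ⟩
    x + 3 + 3 * m′      ≡⟨ +-assoc x 3 (3 * m′) ⟩
    x + (3 + 3 * m′)    ≡⟨ cong (x +_) (*-suc 3 m′) ⟨
    x + 3 * suc m′      ≤⟨ +-monoʳ-≤ x (*-monoʳ-≤ 3 m′<m) ⟩
    x + 3 * m           ≤⟨ ≤B ⟩
    B                   ∎
    where open ≤-Reasoning

  diam-bound : ∀ {M n c k} → 2 ≤ M → 2 * M ≤ n → 6 * M * c ≤ n → k ≤ 3 * c → 2 + k ≤ n
  diam-bound {M} {n} {c} {k} 2≤M 2M≤n 6Mc≤n k≤3c = *-cancelˡ-≤ 4 (begin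
    4 * (2 + k)      ≡⟨ *-distribˡ-+ 4 2 k ⟩
    8 + 4 * k        ≤⟨ +-monoʳ-≤ 8 (*-monoʳ-≤ 4 k≤3c) ⟩
    8 + 4 * (3 * c)  ≡⟨ cong (8 +_) (*-assoc 4 3 c) ⟨
    8 + 12 * c       ≤⟨ +-monoʳ-≤ 8 (*-monoˡ-≤ c (*-monoʳ-≤ 6 2≤M)) ⟩
    8 + 6 * M * c    ≤⟨ +-mono-≤ 8≤3n 6Mc≤n ⟩
    3 * n + n        ≡⟨ +-comm (3 * n) n ⟩
    4 * n            ∎)
    where
    open ≤-Reasoning
    8≤3n : 8 ≤ 3 * n
    8≤3n = ≤-trans (m≤m+n 8 4) (*-monoʳ-≤ 3 (≤-trans (*-monoʳ-≤ 2 2≤M) 2M≤n))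

  core-size-bound : ∀ {M n c c′} → 2 * M ≤ n → 6 * M * c ≤ n → c′ ≤ 1 + 3 * c → M * c′ ≤ n
  core-size-bound {M} {n} {c} {c′} 2M≤n 6Mc≤n c′≤ = *-cancelˡ-≤ 2 (begin
    2 * (M * c′)            ≤⟨ *-monoʳ-≤ 2 (*-monoʳ-≤ M c′≤) ⟩
    2 * (M * (1 + 3 * c))   ≡⟨ expand ⟩
    2 * M + 6 * M * c       ≤⟨ +-mono-≤ 2M≤n 6Mc≤n ⟩
    n + n                   ≡⟨ cong (n +_) (+-identityʳ n) ⟨
    2 * n                   ∎)
    where
    open ≤-Reasoning
    expand : 2 * (M * (1 + 3 * c)) ≡ 2 * M + 6 * M * c
    expand = solve 2 (λ M c → con 2 :* (M :* (con 1 :+ con 3 :* c)) := con 2 :* M :+ con 6 :* M :* c) refl M c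

  module _ {n} (G : Graph n) (connected : Connected G) {D : Subset n} (D-dominating : Dominating G D) where

    missing : Subset n → ℕ
    missing C = ∑[ u < n ] ⟦ u ∈S D ∧ not (u ∈S C) ⟧

    missing-< : ∀ {C C′} x → C ⊆ C′ → x ∈S D ≡ true → x ∈S C ≡ false → x ∈S C′ ≡ true →
      missing C′ < missing C
    missing-< {C} {C′} x C⊆C′ x∈D x∉C x∈C′ = ∑-mono-< pointwise x strict
      where
      pointwise : ∀ u → ⟦ u ∈S D ∧ not (u ∈S C′) ⟧ ≤ ⟦ u ∈S D ∧ not (u ∈S C) ⟧
      pointwise u with true-or-false (u ∈S C)
      ... | inj₁ u∈C rewrite u∈C | C⊆C′ u u∈C = ≤-refl
      ... | inj₂ u∉C rewrite u∉C = ⟦∧⟧≤ (u ∈S D) (not (u ∈S C′))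
        where
        ⟦∧⟧≤ : ∀ a b → ⟦ a ∧ b ⟧ ≤ ⟦ a ∧ true ⟧
        ⟦∧⟧≤ false b = z≤n
        ⟦∧⟧≤ true false = z≤n
        ⟦∧⟧≤ true true = ≤-refl
      strict : ⟦ x ∈S D ∧ not (x ∈S C′) ⟧ < ⟦ x ∈S D ∧ not (x ∈S C) ⟧
      strict rewrite x∈D | x∉C | x∈C′ = s≤s z≤n

    missing≤card : ∀ C → missing C ≤ card D
    missing≤card C = subst (missing C ≤_) (sym (card≡∑ D)) (∑-mono-≤ (λ u → ⟦∧⟧≤ (u ∈S D) (u ∈S C)))
      where
      ⟦∧⟧≤ : ∀ a b → ⟦ a ∧ not b ⟧ ≤ ⟦ a ⟧
      ⟦∧⟧≤ false b = z≤n
      ⟦∧⟧≤ true false = ≤-refl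
      ⟦∧⟧≤ true true = z≤n

    v₀ : Fin n
    v₀ = someVertex G connected

    fresh-dominator : ∀ C b → dominatedᵇ G C b ≡ false → Dominated G D b →
      ∃ λ x → x ∈S D ≡ true × x ∈S C ≡ false × (∀ C′ → b ∈S C′ ≡ true → Dominated G C′ x)
    fresh-dominator C b b-undom (inj₁ b∈D) with true-or-false (b ∈S C)
    ... | inj₁ b∈C = true≢false (dominatedᵇ⁺ G C b (inj₁ b∈C)) b-undom
    ... | inj₂ b∉C = b , b∈D , b∉C , λ C′ b∈C′ → inj₁ b∈C′
    fresh-dominator C b b-undom (inj₂ (x , x∈D , xb)) with true-or-false (x ∈S C)
    ... | inj₁ x∈C = true≢false (dominatedᵇ⁺ G C b (inj₂ (x , x∈C , xb))) b-undom
    ... | inj₂ x∉C = x , x∈D , x∉C , λ C′ b∈C′ → inj₂ (b , b∈C′ , adj-sym G xb)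

    -- An edge ab leaves the part dominated by C; adding a, b and a vertex of D \ C dominating b
    -- raises the diameter by at most 3 and shrinks D \ C.
    extend : ∀ {C k} → DiamAtMost G C k → v₀ ∈S C ≡ true → ∀ y → dominatedᵇ G C y ≡ false →
      ∃ λ C′ → C ⊆ C′ × DiamAtMost G C′ (3 + k) × card C′ ≤ 3 + card C × missing C′ < missing C
    extend {C} {k} diam v₀∈C y y-undom
      with reach-crossing-edge G (fullSet n) n (dominatedᵇ G C) (reach-connected G connected v₀ y)
             (dominatedᵇ⁺ G C v₀ (inj₁ v₀∈C)) y-undom
    ... | a , b , a-dom , b-undom , ab with fresh-dominator C b b-undom (D-dominating b)
    ...   | x , x∈D , x∉C , x-dominated =
      C₃ , C⊆C₃ , diam₃ , card₃ , missing-< {C} {C₃} x C⊆C₃ x∈D x∉C (∈-insert-self x C₂)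
      where
      C₁ = insert a C
      C₂ = insert b C₁
      C₃ = insert x C₂
      C⊆C₃ : C ⊆ C₃
      C⊆C₃ u u∈C = ⊆-insert x C₂ u (⊆-insert b C₁ u (⊆-insert a C u u∈C))
      diam₃ : DiamAtMost G C₃ (3 + k)
      diam₃ = diam-insert G C₂ (2 + k) x
                (diam-insert G C₁ (1 + k) b
                  (diam-insert G C k a diam (dominatedᵇ⁻ G C a a-dom))
                  (inj₂ (a , ∈-insert-self a C , ab)))
                (x-dominated C₂ (∈-insert-self b C₁))
      card₃ : card C₃ ≤ 3 + card C
      card₃ = ≤-trans (card-insert x C₂) (s≤s (≤-trans (card-insert b C₁) (s≤s (card-insert a C))))

    ConnectedDominatingSet : Set
    ConnectedDominatingSet = ∃ λ C → ∃ λ k → DiamAtMost G C k × Dominating G C × v₀ ∈S C ≡ true ×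
      k ≤ 3 * card D × card C ≤ 1 + 3 * card D

    grow : ∀ fuel C k → missing C < fuel → DiamAtMost G C k → v₀ ∈S C ≡ true →
      k + 3 * missing C ≤ 3 * card D → card C + 3 * missing C ≤ 1 + 3 * card D → ConnectedDominatingSet
    grow zero C k () _ _ _ _
    grow (suc fuel) C k m<fuel diam v₀∈C k-bound card-bound with all? (λ v → dominatedᵇ G C v Bool.≟ true)
    ... | yes dominating =
      C , k , diam , (λ v → dominatedᵇ⁻ G C v (dominating v)) , v₀∈C ,
      ≤-trans (m≤m+n k _) k-bound , ≤-trans (m≤m+n (card C) _) card-bound
    ... | no ¬dominating with ¬∀⟶∃¬ n _ (λ v → dominatedᵇ G C v Bool.≟ true) ¬dominating
    ...   | y , y-undom with extend {C} {k} diam v₀∈C y (¬-not y-undom)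
    ...     | C′ , C⊆C′ , diam′ , card′ , drop =
      grow fuel C′ (3 + k) (≤-trans drop (≤-pred m<fuel)) diam′ (C⊆C′ v₀ v₀∈C)
        (potential-drop {k} ≤-refl drop k-bound) (potential-drop {card C} card′ drop card-bound)

    connected-dominating-set : ConnectedDominatingSet
    connected-dominating-set =
      grow (suc (card D)) C₀ 0 (s≤s (missing≤card C₀)) (diam-singleton G v₀) (∈-insert-self v₀ ∅)
        (*-monoʳ-≤ 3 (missing≤card C₀))
        (+-mono-≤ (≤-trans (card-insert v₀ ∅) (s≤s (≤-reflexive (card-∅ {n})))) (*-monoʳ-≤ 3 (missing≤card C₀)))
      where
      C₀ = insert v₀ ∅

  small-upward-connected-set : ∀ {n} (G : Graph n) → Connected G → ∀ {d} → MinDegAtLeast G d →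
    ∀ M → 4 * ((6 * M) * (6 * M)) ≤ suc d → 2 ≤ M → 2 * M ≤ n →
    ∃ λ C → UpwardConnected G C × M * card C ≤ n
  small-upward-connected-set {n} G connected minDeg M big 2≤M 2M≤n =
    fromDominating (small-dominating-set G minDeg (someVertex G connected) (6 * M) big)
    where
    fromDominating : (∃ λ D → Dominating G D × 6 * M * card D ≤ n) →
      ∃ λ C → UpwardConnected G C × M * card C ≤ n
    fromDominating (D , D-dominating , 6MD≤n) =
      fromConnected (connected-dominating-set G connected {D} D-dominating)
      where
      fromConnected : ConnectedDominatingSet G connected {D} D-dominating →
        ∃ λ C → UpwardConnected G C × M * card C ≤ n
      fromConnected (C , k , diam , C-dominating , v₀∈C , k≤ , C≤) =
        C , superset-connected G diam C-dominating (diam-bound {M} 2≤M 2M≤n 6MD≤n k≤) v₀∈C ,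
        core-size-bound {M} 2M≤n 6MD≤n C≤

module SubsetSums where

  open import Defs hiding (sym)
  open Sums
  open Walks using (_⊆_)
  open import Data.Bool using (Bool; true; false; _∧_; _∨_; not)
  open import Data.Fin using (zero; suc)
  open import Data.List using ([]; _∷_; concatMap)
  open import Data.Nat using (ℕ; zero; suc; _+_; _*_; _^_; _≤_; _⊓_; z≤n)
  open import Data.Nat.Properties hiding (_≟_)
  open import Data.Product using (∃; _×_; _,_; proj₂)
  open import Data.Sum using (_⊎_; inj₁; inj₂)
  open import Data.Vec using ([]; _∷_)
  open import Relation.Binary.PropositionalEquality
  import Algebra.Properties.CommutativeSemigroup *-commutativeSemigroup as *-CS

  ^-distrib-* : ∀ a b e → (a * b) ^ e ≡ a ^ e * b ^ e
  ^-distrib-* a b zero = refl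
  ^-distrib-* a b (suc e) rewrite ^-distrib-* a b e = *-CS.interchange a b (a ^ e) (b ^ e)

  ∑-allSubsets-suc : ∀ {n} (h : Subset (suc n) → ℕ) →
    ∑[ S ∈ allSubsets (suc n) ] h S ≡ ∑[ s ∈ allSubsets n ] (h (false ∷ s) + h (true ∷ s))
  ∑-allSubsets-suc {n} h = go (allSubsets n)
    where
    go : ∀ ss → ∑[ S ∈ concatMap (λ s → (false ∷ s) ∷ (true ∷ s) ∷ []) ss ] h S ≡
                ∑[ s ∈ ss ] (h (false ∷ s) + h (true ∷ s))
    go [] = refl
    go (s ∷ ss) rewrite go ss = sym (+-assoc (h (false ∷ s)) (h (true ∷ s)) _)

  cocard : ∀ {n} → Subset n → ℕ
  cocard [] = 0
  cocard (true ∷ s) = cocard s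
  cocard (false ∷ s) = suc (cocard s)

  card+cocard : ∀ {n} (s : Subset n) → card s + cocard s ≡ n
  card+cocard [] = refl
  card+cocard (true ∷ s) = cong suc (card+cocard s)
  card+cocard (false ∷ s) = trans (+-suc (card s) (cocard s)) (cong suc (card+cocard s))

  weight : ℕ → ℕ → ∀ {n} → Subset n → ℕ
  weight a b [] = 1
  weight a b (true ∷ s) = a * weight a b s
  weight a b (false ∷ s) = b * weight a b s

  weight≡ : ∀ a b {n} (s : Subset n) → weight a b s ≡ a ^ card s * b ^ cocard s
  weight≡ a b [] = refl
  weight≡ a b (true ∷ s) rewrite weight≡ a b s = sym (*-assoc a (a ^ card s) (b ^ cocard s))
  weight≡ a b (false ∷ s) rewrite weight≡ a b s = *-CS.x∙yz≈y∙xz b (a ^ card s) (b ^ cocard s)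

  ∑-weight : ∀ a b n → ∑[ s ∈ allSubsets n ] weight a b s ≡ (a + b) ^ n
  ∑-weight a b zero = refl
  ∑-weight a b (suc n) = begin
    ∑[ s ∈ allSubsets (suc n) ] weight a b s                    ≡⟨ ∑-allSubsets-suc {n} (weight a b) ⟩
    ∑[ s ∈ allSubsets n ] (b * weight a b s + a * weight a b s)
      ≡⟨ ∑∈-cong (allSubsets n) (λ s → sym (*-distribʳ-+ (weight a b s) b a)) ⟩
    ∑[ s ∈ allSubsets n ] ((b + a) * weight a b s)               ≡⟨ *-distribˡ-∑∈ (b + a) (weight a b) (allSubsets n) ⟨
    (b + a) * ∑[ s ∈ allSubsets n ] weight a b s                ≡⟨ cong₂ _*_ (+-comm b a) (∑-weight a b n) ⟩
    (a + b) * (a + b) ^ n                                      ∎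
    where open ≡-Reasoning

  _⊆ᵇ_ : ∀ {n} → Subset n → Subset n → Bool
  [] ⊆ᵇ [] = true
  (c ∷ C) ⊆ᵇ (s ∷ S) = (not c ∨ s) ∧ (C ⊆ᵇ S)

  ⊆ᵇ⇒⊆ : ∀ {n} (C S : Subset n) → C ⊆ᵇ S ≡ true → C ⊆ S
  ⊆ᵇ⇒⊆ (c ∷ C) (s ∷ S) e zero c≡true with ∧-true⁻ (not c ∨ s) _ e
  ... | s≡true , _ rewrite c≡true = s≡true
  ⊆ᵇ⇒⊆ (c ∷ C) (s ∷ S) e (suc v) v∈C = ⊆ᵇ⇒⊆ C S (proj₂ (∧-true⁻ (not c ∨ s) _ e)) v v∈C

  #supersets : ∀ {n} (C : Subset n) → (∑[ S ∈ allSubsets n ] ⟦ C ⊆ᵇ S ⟧) * 2 ^ card C ≡ 2 ^ n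
  #supersets [] = refl
  #supersets {suc n} (true ∷ C) = begin
    (∑[ S ∈ allSubsets (suc n) ] ⟦ (true ∷ C) ⊆ᵇ S ⟧) * (2 * 2 ^ card C)
      ≡⟨ cong (_* (2 * 2 ^ card C)) (∑-allSubsets-suc (λ S → ⟦ (true ∷ C) ⊆ᵇ S ⟧)) ⟩
    (∑[ s ∈ allSubsets n ] ⟦ C ⊆ᵇ s ⟧) * (2 * 2 ^ card C)
      ≡⟨ *-CS.x∙yz≈y∙xz (∑[ s ∈ allSubsets n ] ⟦ C ⊆ᵇ s ⟧) 2 (2 ^ card C) ⟩
    2 * ((∑[ s ∈ allSubsets n ] ⟦ C ⊆ᵇ s ⟧) * 2 ^ card C)  ≡⟨ cong (2 *_) (#supersets C) ⟩
    2 * 2 ^ n                                            ∎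
    where open ≡-Reasoning
  #supersets {suc n} (false ∷ C) = begin
    (∑[ S ∈ allSubsets (suc n) ] ⟦ (false ∷ C) ⊆ᵇ S ⟧) * 2 ^ card C
      ≡⟨ cong (_* 2 ^ card C) (∑-allSubsets-suc (λ S → ⟦ (false ∷ C) ⊆ᵇ S ⟧)) ⟩
    (∑[ s ∈ allSubsets n ] (⟦ C ⊆ᵇ s ⟧ + ⟦ C ⊆ᵇ s ⟧)) * 2 ^ card C
      ≡⟨ cong (_* 2 ^ card C) (∑∈-distrib-+ (λ s → ⟦ C ⊆ᵇ s ⟧) (λ s → ⟦ C ⊆ᵇ s ⟧) (allSubsets n)) ⟩
    (X + X) * 2 ^ card C           ≡⟨ cong (_* 2 ^ card C) (cong (X +_) (+-identityʳ X)) ⟨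
    2 * X * 2 ^ card C             ≡⟨ *-assoc 2 X (2 ^ card C) ⟩
    2 * (X * 2 ^ card C)           ≡⟨ cong (2 *_) (#supersets C) ⟩
    2 * 2 ^ n                      ∎
    where
    open ≡-Reasoning
    X = ∑[ s ∈ allSubsets n ] ⟦ C ⊆ᵇ s ⟧

  module _ {A : Set} (β : A → Bool) (w : A → ℕ) {Y e : ℕ}
           (heavy : ∀ x → β x ≡ true → Y ≤ w x ^ suc e) where

    -- m is the least weight of a β-element; it stands in for Y ^ (1 / (1 + e)), which ℕ lacks.
    common-weight : ∀ xs → ∑[ x ∈ xs ] ⟦ β x ⟧ ≡ 0 ⊎
      ∃ λ m → Y ≤ m ^ suc e × (∑[ x ∈ xs ] ⟦ β x ⟧) * m ≤ ∑[ x ∈ xs ] w x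
    common-weight [] = inj₁ refl
    common-weight (x ∷ xs) with true-or-false (β x) | common-weight xs
    ... | inj₂ βx≡false | inj₁ none rewrite βx≡false = inj₁ none
    ... | inj₂ βx≡false | inj₂ (m , Y≤ , c*m≤) rewrite βx≡false = inj₂ (m , Y≤ , ≤-trans c*m≤ (m≤n+m _ (w x)))
    ... | inj₁ βx≡true | inj₁ none rewrite βx≡true | none =
      inj₂ (w x , heavy x βx≡true , +-monoʳ-≤ (w x) z≤n)
    ... | inj₁ βx≡true | inj₂ (m , Y≤ , c*m≤) rewrite βx≡true =
      inj₂ (m ⊓ w x , Y≤min , +-mono-≤ (m⊓n≤n m (w x)) (≤-trans (*-monoʳ-≤ c (m⊓n≤m m (w x))) c*m≤))
      where
      c = ∑[ x ∈ xs ] ⟦ β x ⟧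
      Y≤min : Y ≤ (m ⊓ w x) ^ suc e
      Y≤min with ⊓-sel m (w x)
      ... | inj₁ ≡m rewrite ≡m = Y≤
      ... | inj₂ ≡w rewrite ≡w = heavy x βx≡true

    count-by-weight : ∀ xs → (∑[ x ∈ xs ] ⟦ β x ⟧) ^ suc e * Y ≤ (∑[ x ∈ xs ] w x) ^ suc e
    count-by-weight xs with common-weight xs
    ... | inj₁ none rewrite none = z≤n
    ... | inj₂ (m , Y≤ , c*m≤) = begin
      c ^ suc e * Y           ≤⟨ *-monoʳ-≤ (c ^ suc e) Y≤ ⟩
      c ^ suc e * m ^ suc e   ≡⟨ ^-distrib-* c m (suc e) ⟨
      (c * m) ^ suc e         ≤⟨ ^-monoˡ-≤ (suc e) c*m≤ ⟩
      (∑[ x ∈ xs ] w x) ^ suc e ∎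
      where
      open ≤-Reasoning
      c = ∑[ x ∈ xs ] ⟦ β x ⟧

module BinomialTail where

  open SubsetSums using (^-distrib-*)
  open import Data.Empty using (⊥-elim)
  open import Data.Nat using (ℕ; zero; suc; _+_; _*_; _∸_; _^_; _≤_; _<_; z≤n; s≤s; NonZero; >-nonZero)
  open import Data.Nat.Properties
  open import Data.Nat.Solver using (module +-*-Solver)
  open +-*-Solver using (solve; _:+_; _:*_; _:=_; con)
  open import Relation.Binary.PropositionalEquality
  open import Relation.Nullary using (yes; no)
  import Algebra.Properties.CommutativeSemigroup *-commutativeSemigroup as *-CS

  n<2^n : ∀ n → n < 2 ^ n
  n<2^n zero = s≤s z≤n
  n<2^n (suc n) = begin
    suc (suc n)    ≤⟨ s≤s (m≤n+m (suc n) n) ⟩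
    suc n + suc n  ≤⟨ +-mono-≤ (n<2^n n) (n<2^n n) ⟩
    2 ^ n + 2 ^ n  ≡⟨ cong (2 ^ n +_) (+-identityʳ (2 ^ n)) ⟨
    2 ^ suc n      ∎
    where open ≤-Reasoning

  ^-cancelʳ-≤ : ∀ r .{{_ : NonZero r}} {a b} → a ^ r ≤ b ^ r → a ≤ b
  ^-cancelʳ-≤ r {a} {b} le with a ≤? b
  ... | yes a≤b = a≤b
  ... | no a≰b = ⊥-elim (<⇒≱ (^-monoˡ-< r (≰⇒> a≰b)) le)

  bernoulli : ∀ W M → (W + M) * W ^ M ≤ W * (W + 1) ^ M
  bernoulli W zero = ≤-reflexive (trans (*-identityʳ (W + 0)) (trans (+-identityʳ W) (sym (*-identityʳ W))))
  bernoulli W (suc M) = begin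
    (W + suc M) * (W * W ^ M)
      ≡⟨ solve 3 (λ W M P → (W :+ (con 1 :+ M)) :* (W :* P) := W :* ((W :+ M) :* P) :+ W :* P) refl W M (W ^ M) ⟩
    W * ((W + M) * W ^ M) + W * W ^ M                  ≤⟨ +-monoʳ-≤ (W * ((W + M) * W ^ M)) (m≤m+n (W * W ^ M) (M * W ^ M)) ⟩
    W * ((W + M) * W ^ M) + (W * W ^ M + M * W ^ M)    ≡⟨ cong (W * ((W + M) * W ^ M) +_) (*-distribʳ-+ (W ^ M) W M) ⟨
    W * ((W + M) * W ^ M) + (W + M) * W ^ M            ≤⟨ +-mono-≤ (*-monoʳ-≤ W (bernoulli W M)) (bernoulli W M) ⟩
    W * (W * (W + 1) ^ M) + W * (W + 1) ^ M
      ≡⟨ solve 2 (λ W P → W :* (W :* P) :+ W :* P := W :* ((W :+ con 1) :* P)) refl W ((W + 1) ^ M) ⟩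
    W * ((W + 1) * (W + 1) ^ M)                        ∎
    where open ≤-Reasoning

  K*W^KW≤[W+1]^KW : ∀ W K .{{_ : NonZero W}} → K * W ^ (K * W) ≤ (W + 1) ^ (K * W)
  K*W^KW≤[W+1]^KW W K = *-cancelˡ-≤ W (begin
    W * (K * W ^ (K * W))         ≡⟨ *-CS.x∙yz≈yx∙z W K (W ^ (K * W)) ⟩
    K * W * W ^ (K * W)           ≤⟨ *-monoˡ-≤ (W ^ (K * W)) (m≤n+m (K * W) W) ⟩
    (W + K * W) * W ^ (K * W)     ≤⟨ bernoulli W (K * W) ⟩
    W * (W + 1) ^ (K * W)         ∎)
    where open ≤-Reasoning

  [B+1]^[1+j]≤ : ∀ B j → (B + 1) ^ suc j ≤ B ^ suc j + suc j * (B + 1) ^ j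
  [B+1]^[1+j]≤ B zero = ≤-reflexive (trans (*-identityʳ (B + 1)) (cong (_+ 1) (sym (*-identityʳ B))))
  [B+1]^[1+j]≤ B (suc j) = begin
    (B + 1) * (B + 1) ^ suc j                                 ≤⟨ *-monoʳ-≤ (B + 1) ([B+1]^[1+j]≤ B j) ⟩
    (B + 1) * (B ^ suc j + suc j * (B + 1) ^ j)
      ≡⟨ solve 4 (λ B P Q j → (B :+ con 1) :* (P :+ (con 1 :+ j) :* Q)
                              := B :* P :+ (P :+ (con 1 :+ j) :* ((B :+ con 1) :* Q))) refl B (B ^ suc j) ((B + 1) ^ j) j ⟩
    B * B ^ suc j + (B ^ suc j + suc j * (B + 1) ^ suc j)
      ≤⟨ +-monoʳ-≤ (B * B ^ suc j) (+-monoˡ-≤ (suc j * (B + 1) ^ suc j) (^-monoˡ-≤ (suc j) (m≤m+n B 1))) ⟩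
    B ^ suc (suc j) + suc (suc j) * (B + 1) ^ suc j           ∎
    where open ≤-Reasoning

  module Precision (l : ℕ) where

    L p q e : ℕ
    L = 2 + l
    p = 1 + l
    q = 3 + l
    e = 4 + 2 * l

    W Z : ℕ
    W = L ^ e
    Z = p ^ p * q ^ q

    e≡p+q : e ≡ p + q
    e≡p+q = solve 1 (λ l → con 4 :+ con 2 :* l := (con 1 :+ l) :+ (con 3 :+ l)) refl l

    -- Strict AM-GM for L - 1 and L + 1: L ^ 2L < (L - 1) ^ (L - 1) · (L + 1) ^ (L + 1).
    W<Z : W < Z
    W<Z = +-cancelʳ-≤ X (suc W) Z (begin
      suc W + X              ≤⟨ W+1+X≤ ⟩
      A ^ p * (q * q)        ≤⟨ ≤Z+X ⟩
      Z + X                  ∎)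
      where
      open ≤-Reasoning
      A = L * L
      B = p * q
      X = p * (q * q) * A ^ l
      A≡B+1 : A ≡ B + 1
      A≡B+1 = solve 1 (λ l → (con 2 :+ l) :* (con 2 :+ l) := (con 1 :+ l) :* (con 3 :+ l) :+ con 1) refl l
      W≡ : W ≡ A ^ l * (A * A)
      W≡ = begin-equality
        L ^ (4 + 2 * l)     ≡⟨ cong (L ^_) (solve 1 (λ l → con 4 :+ con 2 :* l := con 2 :* (con 2 :+ l)) refl l) ⟩
        L ^ (2 * (2 + l))   ≡⟨ ^-*-assoc L 2 (2 + l) ⟨
        (L ^ 2) ^ (2 + l)   ≡⟨ cong (λ x → (L * x) ^ (2 + l)) (*-identityʳ L) ⟩
        A ^ (2 + l)         ≡⟨ solve 2 (λ A P → A :* (A :* P) := P :* (A :* A)) refl A (A ^ l) ⟩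
        A ^ l * (A * A)     ∎
      Z≡ : Z ≡ B ^ p * (q * q)
      Z≡ = begin-equality
        p ^ p * q ^ (2 + p)       ≡⟨ cong (p ^ p *_) (^-distribˡ-+-* q 2 p) ⟩
        p ^ p * (q ^ 2 * q ^ p)   ≡⟨ solve 3 (λ P Q Q2 → P :* (Q2 :* Q) := (P :* Q) :* Q2) refl (p ^ p) (q ^ p) (q ^ 2) ⟩
        p ^ p * q ^ p * q ^ 2     ≡⟨ cong₂ _*_ (sym (^-distrib-* p q p)) (cong (q *_) (*-identityʳ q)) ⟩
        B ^ p * (q * q)           ∎
      A²+pq²+1≤Aq² : A * A + p * (q * q) + 1 ≤ A * (q * q)
      A²+pq²+1≤Aq² = ≤-trans (m≤m+n _ (L * L * L + L))
        (≤-reflexive (solve 1 (λ l →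
          (con 2 :+ l) :* (con 2 :+ l) :* ((con 2 :+ l) :* (con 2 :+ l))
            :+ (con 1 :+ l) :* ((con 3 :+ l) :* (con 3 :+ l)) :+ con 1
            :+ ((con 2 :+ l) :* (con 2 :+ l) :* (con 2 :+ l) :+ (con 2 :+ l))
          := (con 2 :+ l) :* (con 2 :+ l) :* ((con 3 :+ l) :* (con 3 :+ l))) refl l))
      W+1+X≤ : suc W + X ≤ A ^ p * (q * q)
      W+1+X≤ = begin
        suc W + X                                     ≡⟨ cong (λ w → suc w + X) W≡ ⟩
        1 + A ^ l * (A * A) + X                       ≤⟨ +-monoˡ-≤ X (+-monoˡ-≤ (A ^ l * (A * A)) (m^n>0 A l)) ⟩
        A ^ l + A ^ l * (A * A) + X
          ≡⟨ solve 3 (λ P A2 c → P :+ P :* A2 :+ c :* P := P :* (A2 :+ c :+ con 1)) refl (A ^ l) (A * A) (p * (q * q)) ⟩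
        A ^ l * (A * A + p * (q * q) + 1)             ≤⟨ *-monoʳ-≤ (A ^ l) A²+pq²+1≤Aq² ⟩
        A ^ l * (A * (q * q))                         ≡⟨ *-CS.x∙yz≈yx∙z (A ^ l) A (q * q) ⟩
        A ^ p * (q * q)                               ∎
      ≤Z+X : A ^ p * (q * q) ≤ Z + X
      ≤Z+X = begin
        A ^ p * (q * q)                       ≡⟨ cong (λ a → a ^ p * (q * q)) A≡B+1 ⟩
        (B + 1) ^ p * (q * q)                 ≤⟨ *-monoˡ-≤ (q * q) ([B+1]^[1+j]≤ B l) ⟩
        (B ^ p + p * (B + 1) ^ l) * (q * q)   ≡⟨ cong (λ a → (B ^ p + p * a ^ l) * (q * q)) A≡B+1 ⟨
        (B ^ p + p * A ^ l) * (q * q)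
          ≡⟨ solve 4 (λ Bp pp Al qq → (Bp :+ pp :* Al) :* qq := Bp :* qq :+ pp :* qq :* Al) refl (B ^ p) p (A ^ l) (q * q) ⟩
        B ^ p * (q * q) + X                   ≡⟨ cong (_+ X) Z≡ ⟨
        Z + X                                 ∎

    M r : ℕ
    M = 2 ^ suc e * W
    r = e * M

    instance
      W≢0 : NonZero W
      W≢0 = m^n≢0 L e
      M≢0 : NonZero M
      M≢0 = m*n≢0 (2 ^ suc e) W {{m^n≢0 2 (suc e)}}
      r≢0 : NonZero r
      r≢0 = m*n≢0 e M
      Z≢0 : NonZero Z
      Z≢0 = >-nonZero (≤-trans (s≤s z≤n) W<Z)

    Z^n≡ : ∀ n → Z ^ n ≡ p ^ (p * n) * q ^ (q * n)
    Z^n≡ n = trans (^-distrib-* (p ^ p) (q ^ q) n) (cong₂ _*_ (^-*-assoc p p n) (^-*-assoc q q n))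

    heavy-weight : ∀ k z → e * k ≤ p * (k + z) → Z ^ (k + z) ≤ (p ^ k * q ^ z) ^ e
    heavy-weight k z ek≤ = begin
      Z ^ (k + z)                                ≡⟨ Z^n≡ (k + z) ⟩
      p ^ (p * (k + z)) * q ^ (q * (k + z))      ≡⟨ cong (λ x → p ^ x * q ^ (q * (k + z))) ek+d≡ ⟨
      p ^ (e * k + d) * q ^ (q * (k + z))        ≡⟨ cong (_* q ^ (q * (k + z))) (^-distribˡ-+-* p (e * k) d) ⟩
      p ^ (e * k) * p ^ d * q ^ (q * (k + z))
        ≤⟨ *-monoˡ-≤ (q ^ (q * (k + z))) (*-monoʳ-≤ (p ^ (e * k)) (^-monoˡ-≤ d (m≤n+m p 2))) ⟩
      p ^ (e * k) * q ^ d * q ^ (q * (k + z))    ≡⟨ *-assoc (p ^ (e * k)) (q ^ d) _ ⟩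
      p ^ (e * k) * (q ^ d * q ^ (q * (k + z)))  ≡⟨ cong (p ^ (e * k) *_) (^-distribˡ-+-* q d (q * (k + z))) ⟨
      p ^ (e * k) * q ^ (d + q * (k + z))        ≡⟨ cong (λ x → p ^ (e * k) * q ^ x) ez≡ ⟨
      p ^ (e * k) * q ^ (e * z)                  ≡⟨ cong₂ _*_ (trans (cong (p ^_) (*-comm e k)) (sym (^-*-assoc p k e)))
                                                              (trans (cong (q ^_) (*-comm e z)) (sym (^-*-assoc q z e))) ⟩
      (p ^ k) ^ e * (q ^ z) ^ e                  ≡⟨ ^-distrib-* (p ^ k) (q ^ z) e ⟨
      (p ^ k * q ^ z) ^ e                        ∎
      where
      open ≤-Reasoning
      d = p * (k + z) ∸ e * k
      ek+d≡ : e * k + d ≡ p * (k + z)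
      ek+d≡ = m+[n∸m]≡n ek≤
      ez≡ : e * z ≡ d + q * (k + z)
      ez≡ = +-cancelˡ-≡ (e * k) (e * z) (d + q * (k + z)) (begin-equality
        e * k + e * z                  ≡⟨ *-distribˡ-+ e k z ⟨
        e * (k + z)                    ≡⟨ cong (_* (k + z)) e≡p+q ⟩
        (p + q) * (k + z)              ≡⟨ *-distribʳ-+ (k + z) p q ⟩
        p * (k + z) + q * (k + z)      ≡⟨ cong (_+ q * (k + z)) ek+d≡ ⟨
        e * k + d + q * (k + z)        ≡⟨ +-assoc (e * k) d _ ⟩
        e * k + (d + q * (k + z))      ∎)

    2*2^e*W^M≤Z^M : 2 * 2 ^ e * W ^ M ≤ Z ^ M
    2*2^e*W^M≤Z^M = ≤-trans (K*W^KW≤[W+1]^KW W (2 ^ suc e)) (^-monoˡ-≤ M (subst (_≤ Z) (+-comm 1 W) W<Z))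

    [p+q]^[neM]≡ : ∀ n → (((p + q) ^ n) ^ e) ^ M ≡ (2 ^ n) ^ r * (W ^ M) ^ n
    [p+q]^[neM]≡ n = begin
      (((p + q) ^ n) ^ e) ^ M                 ≡⟨ cong (λ x → ((x ^ n) ^ e) ^ M) p+q≡2L ⟩
      (((2 * L) ^ n) ^ e) ^ M                 ≡⟨ cong (λ x → (x ^ e) ^ M) (^-distrib-* 2 L n) ⟩
      ((2 ^ n * L ^ n) ^ e) ^ M               ≡⟨ cong (_^ M) (^-distrib-* (2 ^ n) (L ^ n) e) ⟩
      ((2 ^ n) ^ e * (L ^ n) ^ e) ^ M         ≡⟨ ^-distrib-* ((2 ^ n) ^ e) ((L ^ n) ^ e) M ⟩
      ((2 ^ n) ^ e) ^ M * ((L ^ n) ^ e) ^ M   ≡⟨ cong₂ _*_ (^-*-assoc (2 ^ n) e M) L-part ⟩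
      (2 ^ n) ^ r * (W ^ M) ^ n               ∎
      where
      open ≡-Reasoning
      p+q≡2L : p + q ≡ 2 * L
      p+q≡2L = solve 1 (λ l → (con 1 :+ l) :+ (con 3 :+ l) := con 2 :* (con 2 :+ l)) refl l
      L-part : ((L ^ n) ^ e) ^ M ≡ (W ^ M) ^ n
      L-part = begin
        ((L ^ n) ^ e) ^ M   ≡⟨ ^-*-assoc (L ^ n) e M ⟩
        (L ^ n) ^ (e * M)   ≡⟨ ^-*-assoc L n (e * M) ⟩
        L ^ (n * (e * M))   ≡⟨ cong (L ^_) (solve 3 (λ n e M → n :* (e :* M) := e :* (M :* n)) refl n e M) ⟩
        L ^ (e * (M * n))   ≡⟨ ^-*-assoc L e (M * n) ⟨
        W ^ (M * n)         ≡⟨ ^-*-assoc W M n ⟨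
        (W ^ M) ^ n         ∎

    -- T ≤ (2L) ^ n / Z ^ (n / e) and F ≥ 2 ^ (n - n / M); raising to the power r = e M clears the
    -- fractional exponents, W < Z gives (Z / W) ^ M ≥ 2 ^ (e + 1), which pays for 2 ^ (n / M),
    -- and q ^ r ≤ n < 2 ^ n pays for q.
    few-heavy-sets : ∀ {n c T F} → F * 2 ^ c ≡ 2 ^ n → T ^ e * Z ^ n ≤ ((p + q) ^ n) ^ e →
      M * c ≤ n → q ^ r ≤ n → q * T ≤ F
    few-heavy-sets {n} {c} {T} {F} F*2^c≡ T^e*Z^n≤ Mc≤n q^r≤n =
      *-cancelʳ-≤ (q * T) F (2 ^ c) {{m^n≢0 2 c}}
        (≤-trans (^-cancelʳ-≤ r qT2^c^r≤) (≤-reflexive (sym F*2^c≡)))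
      where
      open ≤-Reasoning
      [2^c]^r≤ : (2 ^ c) ^ r ≤ (2 ^ e) ^ n
      [2^c]^r≤ = begin
        (2 ^ c) ^ r          ≡⟨ ^-*-assoc 2 c r ⟩
        2 ^ (c * (e * M))    ≡⟨ cong (2 ^_) (solve 3 (λ c e M → c :* (e :* M) := e :* (M :* c)) refl c e M) ⟩
        2 ^ (e * (M * c))    ≤⟨ ^-monoʳ-≤ 2 (*-monoʳ-≤ e Mc≤n) ⟩
        2 ^ (e * n)          ≡⟨ ^-*-assoc 2 e n ⟨
        (2 ^ e) ^ n          ∎
      q^r≤2^n : q ^ r ≤ 2 ^ n
      q^r≤2^n = ≤-trans q^r≤n (<⇒≤ (n<2^n n))
      qT2^c^r≤ : (q * T * 2 ^ c) ^ r ≤ (2 ^ n) ^ r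
      qT2^c^r≤ = *-cancelʳ-≤ _ _ ((Z ^ n) ^ M) {{m^n≢0 (Z ^ n) M {{m^n≢0 Z n}}}} (begin
        (q * T * 2 ^ c) ^ r * (Z ^ n) ^ M
          ≡⟨ cong (_* (Z ^ n) ^ M) (trans (^-distrib-* (q * T) (2 ^ c) r) (cong (_* (2 ^ c) ^ r) (^-distrib-* q T r))) ⟩
        q ^ r * T ^ (e * M) * (2 ^ c) ^ r * (Z ^ n) ^ M
          ≡⟨ cong (λ x → q ^ r * x * (2 ^ c) ^ r * (Z ^ n) ^ M) (^-*-assoc T e M) ⟨
        q ^ r * (T ^ e) ^ M * (2 ^ c) ^ r * (Z ^ n) ^ M
          ≡⟨ solve 4 (λ a b c d → a :* b :* c :* d := a :* c :* (b :* d)) refl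
                     (q ^ r) ((T ^ e) ^ M) ((2 ^ c) ^ r) ((Z ^ n) ^ M) ⟩
        q ^ r * (2 ^ c) ^ r * ((T ^ e) ^ M * (Z ^ n) ^ M)
          ≡⟨ cong (q ^ r * (2 ^ c) ^ r *_) (^-distrib-* (T ^ e) (Z ^ n) M) ⟨
        q ^ r * (2 ^ c) ^ r * (T ^ e * Z ^ n) ^ M
          ≤⟨ *-mono-≤ (*-mono-≤ q^r≤2^n [2^c]^r≤) (^-monoˡ-≤ M T^e*Z^n≤) ⟩
        2 ^ n * (2 ^ e) ^ n * (((p + q) ^ n) ^ e) ^ M
          ≡⟨ cong (2 ^ n * (2 ^ e) ^ n *_) ([p+q]^[neM]≡ n) ⟩
        2 ^ n * (2 ^ e) ^ n * ((2 ^ n) ^ r * (W ^ M) ^ n)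
          ≡⟨ solve 4 (λ a b c d → a :* b :* (c :* d) := c :* (a :* b :* d)) refl
                     (2 ^ n) ((2 ^ e) ^ n) ((2 ^ n) ^ r) ((W ^ M) ^ n) ⟩
        (2 ^ n) ^ r * (2 ^ n * (2 ^ e) ^ n * (W ^ M) ^ n)
          ≡⟨ cong ((2 ^ n) ^ r *_) (trans (^-distrib-* (2 * 2 ^ e) (W ^ M) n) (cong (_* (W ^ M) ^ n) (^-distrib-* 2 (2 ^ e) n))) ⟨
        (2 ^ n) ^ r * (2 * 2 ^ e * W ^ M) ^ n
          ≤⟨ *-monoʳ-≤ ((2 ^ n) ^ r) (^-monoˡ-≤ n 2*2^e*W^M≤Z^M) ⟩
        (2 ^ n) ^ r * (Z ^ M) ^ n
          ≡⟨ cong ((2 ^ n) ^ r *_) (trans (^-*-assoc Z M n) (trans (cong (Z ^_) (*-comm M n)) (sym (^-*-assoc Z n M)))) ⟩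
        (2 ^ n) ^ r * (Z ^ n) ^ M ∎)

module DensityBounds where

  open import Defs hiding (sym)
  open Sums
  open Walks
  open ConnectedDomination
  open SubsetSums
  open BinomialTail
  open import Data.Bool using (Bool; true; false; _∧_; not)
  open import Data.Bool.Properties using (T-≡)
  open import Data.Empty using (⊥-elim)
  open import Data.List using (length; map)
  open import Data.Nat using (ℕ; zero; suc; _+_; _*_; _^_; _≤_; _<_; _≤?_; z≤n; s≤s)
  open import Data.Nat.ListAction using (sum)
  open import Data.Nat.Properties hiding (_≟_; _≤?_)
  open import Data.Nat.Solver using (module +-*-Solver)
  open +-*-Solver using (solve; _:+_; _:*_; _:=_; con)
  open import Data.Product using (∃; _×_; _,_)
  open import Data.Sum using (inj₁; inj₂)
  open import Function using (Equivalence)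
  open import Relation.Binary.PropositionalEquality
  open import Relation.Nullary using (yes; no)
  open import Relation.Nullary.Decidable using (⌊_⌋; toWitness)

  module _ (l : ℕ) where

    minority : ∀ {good bad T F} → bad ≤ T → F ≤ good + T → (3 + l) * T ≤ F → l * bad ≤ good
    minority {good} {bad} {T} {F} bad≤T F≤ [3+l]T≤F = ≤-trans (*-monoʳ-≤ l bad≤T) (+-cancelˡ-≤ T (l * T) good (begin
      T + l * T          ≤⟨ +-monoʳ-≤ T (*-monoˡ-≤ T (m≤n+m l 2)) ⟩
      T + (2 + l) * T    ≡⟨ solve 2 (λ l T → T :+ (con 2 :+ l) :* T := (con 3 :+ l) :* T) refl l T ⟩
      (3 + l) * T        ≤⟨ [3+l]T≤F ⟩
      F                  ≤⟨ F≤ ⟩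
      good + T           ≡⟨ +-comm good T ⟩
      T + good           ∎))
      where open ≤-Reasoning

    average-from-below : ∀ {n good bad S} → l * bad ≤ good → (1 + l) * n * good ≤ S → l * ((good + bad) * n) ≤ S
    average-from-below {n} {good} {bad} {S} lbad≤ ≤S = begin
      l * ((good + bad) * n)
        ≡⟨ solve 4 (λ l n g b → l :* ((g :+ b) :* n) := l :* n :* g :+ n :* (l :* b)) refl l n good bad ⟩
      l * n * good + n * (l * bad)    ≤⟨ +-monoʳ-≤ (l * n * good) (*-monoʳ-≤ n lbad≤) ⟩
      l * n * good + n * good         ≡⟨ solve 3 (λ l n g → l :* n :* g :+ n :* g := (con 1 :+ l) :* n :* g) refl l n good ⟩
      (1 + l) * n * good              ≤⟨ ≤S ⟩
      S                               ∎
      where open ≤-Reasoning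

    average-from-above : ∀ {n good bad S} → l * bad ≤ good →
      S ≤ (3 + l) * n * good + (4 + 2 * l) * n * bad → S ≤ (4 + l) * ((good + bad) * n)
    average-from-above {n} {good} {bad} {S} lbad≤ S≤ = begin
      S                                                       ≤⟨ S≤ ⟩
      (3 + l) * n * good + (4 + 2 * l) * n * bad
        ≡⟨ solve 4 (λ l n g b → (con 3 :+ l) :* n :* g :+ (con 4 :+ con 2 :* l) :* n :* b
                                := (con 3 :+ l) :* n :* g :+ (con 4 :+ l) :* n :* b :+ n :* (l :* b)) refl l n good bad ⟩
      (3 + l) * n * good + (4 + l) * n * bad + n * (l * bad)
        ≤⟨ +-monoʳ-≤ ((3 + l) * n * good + (4 + l) * n * bad) (*-monoʳ-≤ n lbad≤) ⟩
      (3 + l) * n * good + (4 + l) * n * bad + n * good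
        ≡⟨ solve 4 (λ l n g b → (con 3 :+ l) :* n :* g :+ (con 4 :+ l) :* n :* b :+ n :* g
                                                                   := (con 4 :+ l) :* ((g :+ b) :* n)) refl l n good bad ⟩
      (4 + l) * ((good + bad) * n)                            ∎
      where open ≤-Reasoning

    open Precision l

    -- |S| < (1/2 - 1/e) n and |S| > (1/2 + 1/e) n respectively.
    small large : ∀ {n} → Subset n → Bool
    small {n} S = ⌊ suc (e * card S) ≤? p * n ⌋
    large {n} S = ⌊ suc (q * n) ≤? e * card S ⌋

    #small : ∀ n → (∑[ S ∈ allSubsets n ] ⟦ small S ⟧) ^ e * Z ^ n ≤ ((p + q) ^ n) ^ e
    #small n = subst (λ t → (∑[ S ∈ allSubsets n ] ⟦ small S ⟧) ^ e * Z ^ n ≤ t ^ e) (∑-weight p q n)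
      (count-by-weight small (weight p q) {Z ^ n} {3 + 2 * l} heavy (allSubsets n))
      where
      heavy : ∀ S → small S ≡ true → Z ^ n ≤ weight p q S ^ e
      heavy S small≡ = subst₂ (λ m w → Z ^ m ≤ w ^ e) (card+cocard S) (sym (weight≡ p q S))
        (heavy-weight (card S) (cocard S) (subst (λ m → e * card S ≤ p * m) (sym (card+cocard S)) e|S|≤pn))
        where
        e|S|≤pn : e * card S ≤ p * n
        e|S|≤pn = <⇒≤ (toWitness (Equivalence.from T-≡ small≡))

    #large : ∀ n → (∑[ S ∈ allSubsets n ] ⟦ large S ⟧) ^ e * Z ^ n ≤ ((p + q) ^ n) ^ e
    #large n = subst (λ t → (∑[ S ∈ allSubsets n ] ⟦ large S ⟧) ^ e * Z ^ n ≤ t ^ e)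
      (trans (∑-weight q p n) (cong (_^ n) (+-comm q p)))
      (count-by-weight large (weight q p) {Z ^ n} {3 + 2 * l} heavy (allSubsets n))
      where
      heavy : ∀ S → large S ≡ true → Z ^ n ≤ weight q p S ^ e
      heavy S large≡ = subst₂ (λ m w → Z ^ m ≤ w ^ e) cocard+card
        (trans (*-comm (p ^ cocard S) (q ^ card S)) (sym (weight≡ q p S)))
        (heavy-weight (cocard S) (card S) (subst (λ m → e * cocard S ≤ p * m) (sym cocard+card) e|S̄|≤pn))
        where
        cocard+card : cocard S + card S ≡ n
        cocard+card = trans (+-comm (cocard S) (card S)) (card+cocard S)
        qn<e|S| : q * n < e * card S
        qn<e|S| = toWitness (Equivalence.from T-≡ large≡)
        e|S̄|≤pn : e * cocard S ≤ p * n
        e|S̄|≤pn = +-cancelʳ-≤ (q * n) (e * cocard S) (p * n) (begin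
          e * cocard S + q * n        ≤⟨ +-monoʳ-≤ (e * cocard S) (<⇒≤ qn<e|S|) ⟩
          e * cocard S + e * card S   ≡⟨ *-distribˡ-+ e (cocard S) (card S) ⟨
          e * (cocard S + card S)     ≡⟨ cong (e *_) cocard+card ⟩
          e * n                       ≡⟨ cong (_* n) e≡p+q ⟩
          (p + q) * n                 ≡⟨ *-distribʳ-+ n p q ⟩
          p * n + q * n               ∎)
          where open ≤-Reasoning

    module _ {n} (G : Graph n) (C : Subset n) (C-up : UpwardConnected G C)
             (Mc≤n : M * card C ≤ n) (q^r≤n : q ^ r ≤ n) where

      private
        conn : Subset n → Bool
        conn = isConnectedSet G

        #_ : (Subset n → Bool) → ℕ
        # β = ∑[ S ∈ allSubsets n ] ⟦ β S ⟧

        C⊆ᵇ : Subset n → Bool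
        C⊆ᵇ S = C ⊆ᵇ S

      connected-split : (bad : Subset n → Bool) → # conn ≡ # (λ S → conn S ∧ not (bad S)) + # (λ S → conn S ∧ bad S)
      connected-split bad = trans (∑∈-cong (allSubsets n) (λ S → ⟦⟧-split (conn S) (bad S)))
                                  (∑∈-distrib-+ (λ S → ⟦ conn S ∧ not (bad S) ⟧) (λ S → ⟦ conn S ∧ bad S ⟧) (allSubsets n))
        where
        ⟦⟧-split : ∀ c b → ⟦ c ⟧ ≡ ⟦ c ∧ not b ⟧ + ⟦ c ∧ b ⟧
        ⟦⟧-split false b = refl
        ⟦⟧-split true false = refl
        ⟦⟧-split true true = refl

      supersets≤ : (bad : Subset n → Bool) → # C⊆ᵇ ≤ # (λ S → conn S ∧ not (bad S)) + # bad
      supersets≤ bad = ≤-trans (∑∈-mono-≤ (allSubsets n) pointwise)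
        (≤-reflexive (∑∈-distrib-+ (λ S → ⟦ conn S ∧ not (bad S) ⟧) (λ S → ⟦ bad S ⟧) (allSubsets n)))
        where
        pointwise : ∀ S → ⟦ C ⊆ᵇ S ⟧ ≤ ⟦ conn S ∧ not (bad S) ⟧ + ⟦ bad S ⟧
        pointwise S with true-or-false (C ⊆ᵇ S)
        ... | inj₂ C⊈S rewrite C⊈S = z≤n
        ... | inj₁ C⊆S rewrite C⊆S | C-up S (⊆ᵇ⇒⊆ C S C⊆S) with bad S
        ...   | true = ≤-refl
        ...   | false = s≤s z≤n

      bad-minority : (bad : Subset n → Bool) → (# bad) ^ e * Z ^ n ≤ ((p + q) ^ n) ^ e →
        l * # (λ S → conn S ∧ bad S) ≤ # (λ S → conn S ∧ not (bad S))
      bad-minority bad #bad≤ =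
        minority (∑∈-mono-≤ (allSubsets n) (λ S → ⟦∧⟧≤ (conn S) (bad S))) (supersets≤ bad)
          (few-heavy-sets {T = # bad} (#supersets C) #bad≤ Mc≤n q^r≤n)
        where
        ⟦∧⟧≤ : ∀ c b → ⟦ c ∧ b ⟧ ≤ ⟦ b ⟧
        ⟦∧⟧≤ false b = z≤n
        ⟦∧⟧≤ true b = ≤-refl

      ∑size : ℕ
      ∑size = ∑[ S ∈ allSubsets n ] (⟦ conn S ⟧ * card S)

      size-from-below : l * (# conn * n) ≤ e * ∑size
      size-from-below = subst (λ N → l * (N * n) ≤ e * ∑size) (sym (connected-split small)) (
        average-from-below {n} (bad-minority small (#small n)) (begin
          p * n * ∑[ S ∈ allSubsets n ] ⟦ conn S ∧ not (small S) ⟧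
            ≡⟨ *-distribˡ-∑∈ (p * n) (λ S → ⟦ conn S ∧ not (small S) ⟧) (allSubsets n) ⟩
          ∑[ S ∈ allSubsets n ] (p * n * ⟦ conn S ∧ not (small S) ⟧)
            ≤⟨ ∑∈-mono-≤ (allSubsets n) pointwise ⟩
          ∑[ S ∈ allSubsets n ] (e * (⟦ conn S ⟧ * card S))
            ≡⟨ *-distribˡ-∑∈ e (λ S → ⟦ conn S ⟧ * card S) (allSubsets n) ⟨
          e * ∑size ∎))
        where
        open ≤-Reasoning
        pointwise : ∀ S → p * n * ⟦ conn S ∧ not (small S) ⟧ ≤ e * (⟦ conn S ⟧ * card S)
        pointwise S with conn S | suc (e * card S) ≤? p * n
        ... | false | _ = ≤-trans (≤-reflexive (*-zeroʳ (p * n))) z≤n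
        ... | true | yes _ = ≤-trans (≤-reflexive (*-zeroʳ (p * n))) z≤n
        ... | true | no e|S|≮pn = begin
          p * n * 1          ≡⟨ *-identityʳ (p * n) ⟩
          p * n              ≤⟨ ≮⇒≥ e|S|≮pn ⟩
          e * card S         ≡⟨ cong (e *_) (*-identityˡ (card S)) ⟨
          e * (1 * card S)   ∎

      size-from-above : e * ∑size ≤ (4 + l) * (# conn * n)
      size-from-above = subst (λ N → e * ∑size ≤ (4 + l) * (N * n)) (sym (connected-split large)) (
        average-from-above {n} (bad-minority large (#large n)) (begin
          e * ∑size
            ≡⟨ *-distribˡ-∑∈ e (λ S → ⟦ conn S ⟧ * card S) (allSubsets n) ⟩
          ∑[ S ∈ allSubsets n ] (e * (⟦ conn S ⟧ * card S))
            ≤⟨ ∑∈-mono-≤ (allSubsets n) pointwise ⟩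
          ∑[ S ∈ allSubsets n ] (q * n * ⟦ conn S ∧ not (large S) ⟧ + e * n * ⟦ conn S ∧ large S ⟧)
            ≡⟨ ∑∈-distrib-+ (λ S → q * n * ⟦ conn S ∧ not (large S) ⟧) (λ S → e * n * ⟦ conn S ∧ large S ⟧) (allSubsets n) ⟩
          ∑[ S ∈ allSubsets n ] (q * n * ⟦ conn S ∧ not (large S) ⟧) + ∑[ S ∈ allSubsets n ] (e * n * ⟦ conn S ∧ large S ⟧)
            ≡⟨ cong₂ _+_ (*-distribˡ-∑∈ (q * n) (λ S → ⟦ conn S ∧ not (large S) ⟧) (allSubsets n))
                         (*-distribˡ-∑∈ (e * n) (λ S → ⟦ conn S ∧ large S ⟧) (allSubsets n)) ⟨
          q * n * # (λ S → conn S ∧ not (large S)) + e * n * # (λ S → conn S ∧ large S) ∎))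
        where
        open ≤-Reasoning
        pointwise : ∀ S → e * (⟦ conn S ⟧ * card S) ≤ q * n * ⟦ conn S ∧ not (large S) ⟧ + e * n * ⟦ conn S ∧ large S ⟧
        pointwise S with conn S | suc (q * n) ≤? e * card S
        ... | false | _ = ≤-trans (≤-reflexive (*-zeroʳ e)) z≤n
        ... | true | yes _ = begin
          e * (1 * card S)             ≤⟨ *-monoʳ-≤ e (≤-trans (≤-reflexive (*-identityˡ (card S))) (card≤n S)) ⟩
          e * n                        ≡⟨ *-identityʳ (e * n) ⟨
          e * n * 1                    ≤⟨ m≤n+m (e * n * 1) (q * n * 0) ⟩
          q * n * 0 + e * n * 1        ∎
        ... | true | no qn≮e|S| = begin
          e * (1 * card S)             ≡⟨ cong (e *_) (*-identityˡ (card S)) ⟩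
          e * card S                   ≤⟨ ≮⇒≥ qn≮e|S| ⟩
          q * n                        ≡⟨ *-identityʳ (q * n) ⟨
          q * n * 1                    ≤⟨ m≤m+n (q * n * 1) (e * n * 0) ⟩
          q * n * 1 + e * n * 0        ∎

      some-connected-set : 1 ≤ # conn
      some-connected-set = ≤-trans supersets≥1 (∑∈-mono-≤ (allSubsets n) pointwise)
        where
        supersets≥1 : 1 ≤ # C⊆ᵇ
        supersets≥1 with # C⊆ᵇ | #supersets C
        ... | zero | 0≡2^n = ⊥-elim (<⇒≱ (m^n>0 2 n) (≤-reflexive (sym 0≡2^n)))
        ... | suc _ | _ = s≤s z≤n
        pointwise : ∀ S → ⟦ C ⊆ᵇ S ⟧ ≤ ⟦ conn S ⟧
        pointwise S with true-or-false (C ⊆ᵇ S)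
        ... | inj₂ C⊈S rewrite C⊈S = z≤n
        ... | inj₁ C⊆S rewrite C⊆S | C-up S (⊆ᵇ⇒⊆ C S C⊆S) = ≤-refl

    -- Enough for a dominating set of size n / 6M, and forces n ≥ 2M and n ≥ q ^ r.
    Δ : ℕ
    Δ = 4 * ((6 * M) * (6 * M)) + 2 * M + q ^ r

    density-bounds : ∀ {n} (G : Graph n) → Connected G → MinDegAtLeast G Δ →
      let N = length (connectedSets G) ; Σ = sum (map card (connectedSets G)) in
      l * (N * n) ≤ e * Σ × e * Σ ≤ (4 + l) * (N * n) × 1 ≤ N * n
    density-bounds {n} G connected minDeg =
      bounds (small-upward-connected-set G connected minDeg M
               (≤-trans (m≤m+n (4 * (6 * M * (6 * M))) (2 * M + q ^ r)) (≤-trans (≤-reflexive (sym Δ≡)) (n≤1+n Δ))) 2≤M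
               (≤-trans (m≤n+m (2 * M) (4 * (6 * M * (6 * M)))) (≤-trans (m≤m+n _ (q ^ r)) Δ≤n)))
      where
      Δ≡ : Δ ≡ 4 * (6 * M * (6 * M)) + (2 * M + q ^ r)
      Δ≡ = +-assoc (4 * (6 * M * (6 * M))) (2 * M) (q ^ r)
      Δ≤n : Δ ≤ n
      Δ≤n = ≤-trans (minDeg (someVertex G connected)) (degree≤n G (someVertex G connected))
      2≤M : 2 ≤ M
      2≤M = *-mono-≤ (*-monoʳ-≤ 2 (m^n>0 2 e)) (m^n>0 L e)
      Bounds : ℕ → ℕ → Set
      Bounds N Σ = l * (N * n) ≤ e * Σ × e * Σ ≤ (4 + l) * (N * n) × 1 ≤ N * n
      bounds : (∃ λ C → UpwardConnected G C × M * card C ≤ n) →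
        Bounds (length (connectedSets G)) (sum (map card (connectedSets G)))
      bounds (C , C-up , Mc≤n) =
        subst₂ Bounds (sym (length-filter (isConnectedSet G) (allSubsets n)))
                      (sym (∑∈-filter (isConnectedSet G) card (allSubsets n)))
          (size-from-below G C C-up Mc≤n q^r≤n , size-from-above G C C-up Mc≤n q^r≤n ,
           *-mono-≤ (some-connected-set G C C-up Mc≤n q^r≤n) (≤-trans (m^n>0 q r) q^r≤n))
        where
        q^r≤n : q ^ r ≤ n
        q^r≤n = ≤-trans (m≤n+m (q ^ r) (4 * (6 * M * (6 * M)) + 2 * M)) Δ≤n

module RationalBound where

  open import Defs using (ratio)
  open import Data.Integer as ℤ using (+_; -[1+_]; +[1+_]; _⊖_; +≤+; +<+)
  import Data.Integer.Properties as ℤ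
  open import Data.Nat using (ℕ; zero; suc; _+_; _*_; _∸_; _≤_; _≤?_)
  open import Data.Nat.Properties
  open import Data.Nat.Solver using (module +-*-Solver)
  open +-*-Solver using (solve; _:+_; _:*_; _:=_; con)
  open import Data.Rational using (ℚ; mkℚ; _<_; _-_; -_; ∣_∣; ½; 0ℚ; toℚᵘ; *<*)
  import Data.Rational.Properties as ℚ
  open import Data.Rational.Unnormalised as ℚᵘ using (ℚᵘ; mkℚᵘ; *≤*)
  import Data.Rational.Unnormalised.Properties as ℚᵘ
  open import Relation.Binary.PropositionalEquality
  open import Relation.Nullary using (yes; no)

  ∣2s⊖m∣*[2+l]≤2m : ∀ l s m → l * m ≤ (4 + 2 * l) * s → (4 + 2 * l) * s ≤ (4 + l) * m →
    ℤ.∣ s * 2 ⊖ m ∣ * (2 + l) ≤ m * 2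
  ∣2s⊖m∣*[2+l]≤2m l s m lm≤ ≤[4+l]m with m ≤? s * 2
  ... | yes m≤2s = begin
    ℤ.∣ s * 2 ⊖ m ∣ * (2 + l)        ≡⟨ cong (_* (2 + l)) (trans (ℤ.∣m⊖n∣≡∣n⊖m∣ (s * 2) m) (ℤ.∣⊖∣-≤ m≤2s)) ⟩
    (s * 2 ∸ m) * (2 + l)            ≡⟨ *-distribʳ-∸ (2 + l) (s * 2) m ⟩
    s * 2 * (2 + l) ∸ m * (2 + l)    ≤⟨ m≤n+o⇒m∸n≤o (s * 2 * (2 + l)) (m * (2 + l)) (begin
      s * 2 * (2 + l)                ≡⟨ solve 2 (λ s l → s :* con 2 :* (con 2 :+ l) := (con 4 :+ con 2 :* l) :* s) refl s l ⟩
      (4 + 2 * l) * s                ≤⟨ ≤[4+l]m ⟩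
      (4 + l) * m                    ≡⟨ solve 2 (λ m l → (con 4 :+ l) :* m := m :* (con 2 :+ l) :+ m :* con 2) refl m l ⟩
      m * (2 + l) + m * 2            ∎) ⟩
    m * 2                            ∎
    where open ≤-Reasoning
  ... | no m≰2s = begin
    ℤ.∣ s * 2 ⊖ m ∣ * (2 + l)        ≡⟨ cong (_* (2 + l)) (ℤ.∣⊖∣-< (≰⇒> m≰2s)) ⟩
    (m ∸ s * 2) * (2 + l)            ≡⟨ *-distribʳ-∸ (2 + l) m (s * 2) ⟩
    m * (2 + l) ∸ s * 2 * (2 + l)    ≤⟨ m≤n+o⇒m∸n≤o (m * (2 + l)) (s * 2 * (2 + l)) (begin
      m * (2 + l)                    ≡⟨ solve 2 (λ m l → m :* (con 2 :+ l) := l :* m :+ m :* con 2) refl m l ⟩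
      l * m + m * 2                  ≤⟨ +-monoˡ-≤ (m * 2) lm≤ ⟩
      (4 + 2 * l) * s + m * 2
        ≡⟨ cong (_+ m * 2) (solve 2 (λ s l → (con 4 :+ con 2 :* l) :* s := s :* con 2 :* (con 2 :+ l)) refl s l) ⟩
      s * 2 * (2 + l) + m * 2        ∎) ⟩
    m * 2                            ∎
    where open ≤-Reasoning

  ∣s/m-½∣≤1/[2+l] : ∀ l s m′ → l * suc m′ ≤ (4 + 2 * l) * s → (4 + 2 * l) * s ≤ (4 + l) * suc m′ →
    ℚᵘ.∣ mkℚᵘ (+ s) m′ ℚᵘ.- mkℚᵘ (+ 1) 1 ∣ ℚᵘ.≤ mkℚᵘ (+ 1) (suc l)
  ∣s/m-½∣≤1/[2+l] l s m′ lm≤ ≤[4+l]m =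
    *≤* (subst₂ ℤ._≤_ (sym numerator≡) (sym (ℤ.*-identityˡ _)) (+≤+ (∣2s⊖m∣*[2+l]≤2m l s (suc m′) lm≤ ≤[4+l]m)))
    where
    numerator≡ : ℚᵘ.numerator ℚᵘ.∣ mkℚᵘ (+ s) m′ ℚᵘ.- mkℚᵘ (+ 1) 1 ∣ ℤ.* + (2 + l)
                 ≡ + (ℤ.∣ s * 2 ⊖ suc m′ ∣ * (2 + l))
    numerator≡ = trans (cong (λ z → + ℤ.∣ z ∣ ℤ.* + (2 + l))
                   (trans (cong₂ ℤ._+_ (sym (ℤ.pos-* s 2)) (ℤ.-1*i≡-i (+ suc m′))) (ℤ.m-n≡m⊖n (s * 2) (suc m′))))
                 (sym (ℤ.pos-* ℤ.∣ s * 2 ⊖ suc m′ ∣ (2 + l)))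

  -- ε = a / (l + 1) in lowest terms with a ≥ 1, so 1 / (l + 2) < ε.
  precision : ℚ → ℕ
  precision = ℚ.denominator-1

  1/[2+precision]<ε : ∀ ε → 0ℚ < ε → mkℚᵘ (+ 1) (suc (precision ε)) ℚᵘ.< toℚᵘ ε
  1/[2+precision]<ε (mkℚ (+ zero) _ _) (*<* (+<+ ()))
  1/[2+precision]<ε (mkℚ +[1+ a ] l _) _ =
    ℚᵘ.*<* (subst₂ ℤ._<_ (ℤ.pos-* 1 (suc l)) (ℤ.pos-* (suc a) (2 + l)) (+<+ (begin
      suc (1 * suc l)         ≡⟨ cong suc (*-identityˡ (suc l)) ⟩
      2 + l                   ≤⟨ m≤m+n (2 + l) (a * (2 + l)) ⟩
      suc a * (2 + l)         ∎)))
    where open ≤-Reasoning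
  1/[2+precision]<ε (mkℚ -[1+ _ ] _ _) (*<* ())

  ∣ratio-½∣<ε : ∀ ε → 0ℚ < ε → ∀ s m → 1 ≤ m → let l = precision ε in
    l * m ≤ (4 + 2 * l) * s → (4 + 2 * l) * s ≤ (4 + l) * m → ∣ ratio s m - ½ ∣ < ε
  ∣ratio-½∣<ε ε 0<ε s (suc m′) _ lm≤ ≤[4+l]m = ℚ.toℚᵘ-cancel-<
    (ℚᵘ.≤-<-trans (ℚᵘ.≤-respˡ-≃ (ℚᵘ.≃-sym toℚᵘ-∣ratio-½∣) (∣s/m-½∣≤1/[2+l] (precision ε) s m′ lm≤ ≤[4+l]m))
                  (1/[2+precision]<ε ε 0<ε))
    where
    toℚᵘ-∣ratio-½∣ : toℚᵘ ∣ ratio s (suc m′) - ½ ∣ ℚᵘ.≃ ℚᵘ.∣ mkℚᵘ (+ s) m′ ℚᵘ.- mkℚᵘ (+ 1) 1 ∣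
    toℚᵘ-∣ratio-½∣ = ℚᵘ.≃-trans (ℚ.toℚᵘ-homo-∣-∣ (ratio s (suc m′) - ½)) (ℚᵘ.∣-∣-cong
      (ℚᵘ.≃-trans (ℚ.toℚᵘ-homo-+ (ratio s (suc m′)) (- ½))
        (ℚᵘ.+-cong (ℚ.toℚᵘ-fromℚᵘ (mkℚᵘ (+ s) m′)) (ℚ.toℚᵘ-homo‿- ½))))

open import Defs
open import Data.Nat using (ℕ; _≤_)
open import Data.Product using (∃)
open import Data.Rational using (ℚ; _<_; _-_; ∣_∣; ½; 0ℚ)
open import Data.Product using (_,_)
open DensityBounds using (Δ; density-bounds)
open RationalBound using (precision; ∣ratio-½∣<ε)

mainTheorem12 :
    (order : ℕ → ℕ) (G : (k : ℕ) → Graph (order k)) →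
    (∀ k → Connected (G k)) →
    (∀ (M : ℕ) → ∃ λ N → ∀ k → N ≤ k → MinDegAtLeast (G k) M) →
    ∀ (ε : ℚ) → 0ℚ < ε → ∃ λ N → ∀ k → N ≤ k → ∣ density (G k) - ½ ∣ < ε
mainTheorem12 order G connected minDeg→∞ ε 0<ε with minDeg→∞ (Δ (precision ε))
... | N , largeMinDeg = N , λ k N≤k →
  let lower , upper , nonempty = density-bounds (precision ε) (G k) (connected k) (largeMinDeg k N≤k)
  in ∣ratio-½∣<ε ε 0<ε _ _ nonempty lower upper
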